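{- Let $n\ge 1$ and let $\lambda$ be a partition of expanse $n+1$, and let $(\tau_1,\dots,\tau_n)=\phi(\lambda)\in\{0,1\}^n$. Then $$F_\lambda(q)=W_1\Big(\prod_{i=1}^n\big(\tau_iD_1+(1-\tau_i)E_1\big)\Big)V_1,$$ where the product is taken in order $i=1,\dots,n$ from left to right. Moreover, the generating function $F^{n+1}(q)=\sum_{\mathcal T}q^{\mathrm{wt}(\mathcal T)}\alpha^{ -f(\mathcal T)}\beta^{ -u(\mathcal T)}$, summed over all permutation tableaux $\mathcal T$ of expanse $n+1$, equals $W_1(D_1+E_1)^nV_1$.
   Context: A partition $\lambda=(\lambda_1\ge\dots\ge\lambda_k\ge0)$ is allowed to have parts equal to $0$, and partitions differing in their number of zero parts are distinguished. Its Young diagram has $k$ left-justified rows, row $i$ (from the top) having $\lambda_i$ boxes; it has $\lambda_1$ columns. The expanse of $\lambda$ is $k+\lambda_1$ (number of rows plus number of columns). The boundary of the diagram, read from the north-east corner to the south-west corner, is a word $p=p_1\cdots p_{k+\lambda_1}$ in unit steps $S$ (south) and $W$ (west), with $p_1=S$; this gives a bijection between partitions of expanse $n+1$ and words in $\{S,W\}^{n+1}$ starting with $S$ (explicitly, if $p$ has $k$ letters $S$ and $m$ letters $W$ and the $j$-th $S$ is preceded by $w_j$ letters $W$, the partition is $(m-w_1,\dots,m-w_k)$). Define $\phi(\lambda)=(\tau_1,\dots,\tau_n)\in\{0,1\}^n$ by $\tau_i=1$ iff $p_{i+1}=S$. A permutation tableau of shape $\lambda$ is a filling of the boxes of the Young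 diagram of $\lambda$ with $0$'s and $1$'s such that (1) every column contains at least one $1$, and (2) there is no $0$ which has a $1$ above it in the same column and a $1$ to its left in the same row. Its expanse is that of $\lambda$. For such a tableau $\mathcal T$ with $m$ columns: $\mathrm{wt}(\mathcal T)$ is the number of $1$'s minus $m$; $f(\mathcal T)$ is the number of $1$'s in the top row; an entry is restricted if it is a $0$ lying below some $1$ in its column, a row is unrestricted if it contains no restricted entry, and $u(\mathcal T)$ is the number of unrestricted rows minus $1$. Define $F_\lambda(q)=\sum_{\mathcal T}q^{\mathrm{wt}(\mathcal T)}\alpha^{ -f(\mathcal T)}\beta^{ -u(\mathcal T)}$, the sum over all permutation tableaux of shape $\lambda$. $D_1=(d_{ij})_{i,j\ge1}$ is the infinite matrix with $d_{i,i+1}=\beta^{ -1}$ and all other entries $0$. $E_1=(e_{ij})_{i,j\ge1}$ has $e_{ij}=\beta^{i-j}\big(\alpha^{ -1}q^{j-1}\binom{i-1}{j-1}+\sum_{r=0}^{j-2}\binom{i-j+r}{r}q^r\big)$ for $j\le i$ and $e_{ij}=0$ for $j>i$. $W_1=(1,0,0,\dots)$ and $V_1=(1,1,1,\dots)^T$. All products are well defined (only finitely many nonzero terms occur in each sum), so $W_1MV_1$ is the (finite) sum of the entries of the top row of $M$. -}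

module Defs where

open import Level using (Level)
open import Data.Bool using (Bool; true; false; not; _∧_; if_then_else_)
open import Data.Nat using (ℕ; zero; suc; _∸_; _≡ᵇ_; _≤ᵇ_)
import Data.Nat as ℕ
open import Data.Nat.Combinatorics using (_C_)
open import Data.List using (List; []; _∷_; map; concatMap; upTo; length; foldr; replicate; _++_; tail)
open import Data.Bool.ListAction using (any; all)
open import Data.Maybe using (Maybe; just; nothing; maybe)
open import Function using (id)
open import Algebra.Bundles using (CommutativeRing)

firstPart : List ℕ → ℕ
firstPart []      = 0
firstPart (a ∷ _) = a

expanse : List ℕ → ℕ
expanse λ′ = length λ′ ℕ.+ firstPart λ′

-- Boundary letters: true = S (south), false = W (west).
-- Read from NE corner to SW corner: for each row j, (λ_{j-1} - λ_j) W's then S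
-- (with λ_0 = λ₁ = m), finally λ_k W's.  So the j-th S is preceded by m - λ_j W's.
boundaryFrom : ℕ → List ℕ → List Bool
boundaryFrom prev []      = replicate prev false
boundaryFrom prev (a ∷ λ′) = replicate (prev ∸ a) false ++ (true ∷ boundaryFrom a λ′)

boundary : List ℕ → List Bool
boundary λ′ = boundaryFrom (firstPart λ′) λ′

-- φ(λ) = (τ_1,…,τ_n), τ_i = 1 (true) iff p_{i+1} = S
φ : List ℕ → List Bool
φ λ′ = maybe id [] (tail (boundary λ′))

bounded : ℕ → ℕ → List (List ℕ)
bounded zero    m = [] ∷ []
bounded (suc k) m = concatMap (λ a → map (a ∷_) (bounded k a)) (upTo (suc m))

-- all partitions of expanse N: k+1 rows (k+1 ≤ N), first part N ∸ (k+1)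
partitionsOfExpanse : ℕ → List (List ℕ)
partitionsOfExpanse N =
  concatMap (λ k → map ((N ∸ suc k) ∷_) (bounded k (N ∸ suc k))) (upTo N)

Filling : Set
Filling = List (List Bool)   -- rows, top to bottom; true = 1, false = 0

boolLists : ℕ → List (List Bool)
boolLists zero    = [] ∷ []
boolLists (suc l) = concatMap (λ b → map (b ∷_) (boolLists l)) (true ∷ false ∷ [])

fillingsOf : List ℕ → List Filling
fillingsOf []       = [] ∷ []
fillingsOf (a ∷ λ′) = concatMap (λ r → map (r ∷_) (fillingsOf λ′)) (boolLists a)

at : {A : Set} → List A → ℕ → Maybe A
at []       _       = nothing
at (x ∷ _)  zero    = just x
at (_ ∷ xs) (suc i) = at xs i

ent : Filling → ℕ → ℕ → Maybe Bool
ent T i j with at T i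
... | nothing = nothing
... | just r  = at r j

-- box (i,j) (0-indexed row i, column j) exists and contains 1 / contains 0
isOne : Filling → ℕ → ℕ → Bool
isOne T i j = maybe id false (ent T i j)

isZero : Filling → ℕ → ℕ → Bool
isZero T i j = maybe not false (ent T i j)

count : ℕ → (ℕ → Bool) → ℕ
count N p = foldr (λ i acc → if p i then suc acc else acc) 0 (upTo N)

module _ (λ′ : List ℕ) (T : Filling) where
  private
    k = length λ′
    m = firstPart λ′

  cond1 : Bool
  cond1 = all (λ j → any (λ i → isOne T i j) (upTo k)) (upTo m)

  cond2 : Bool
  cond2 = all (λ i → all (λ j →
            not (isZero T i j ∧ any (λ i′ → isOne T i′ j) (upTo i)
                              ∧ any (λ j′ → isOne T i j′) (upTo j)))
            (upTo m)) (upTo k)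

  isPermTableau : Bool
  isPermTableau = cond1 ∧ cond2

  restricted : ℕ → ℕ → Bool
  restricted i j = isZero T i j ∧ any (λ i′ → isOne T i′ j) (upTo i)

  unrestrictedRow : ℕ → Bool
  unrestrictedRow i = not (any (λ j → restricted i j) (upTo m))

  numOnes : ℕ
  numOnes = foldr (λ i acc → count m (isOne T i) ℕ.+ acc) 0 (upTo k)

  wt : ℕ
  wt = numOnes ∸ m

  fStat : ℕ
  fStat = count m (isOne T 0)

  uStat : ℕ
  uStat = count k unrestrictedRow ∸ 1

module WithRing {c ℓ : Level} (R : CommutativeRing c ℓ)
                (q α⁻¹ β β⁻¹ : CommutativeRing.Carrier R) where
  open CommutativeRing R

  pow : Carrier → ℕ → Carrier
  pow x zero    = 1#
  pow x (suc n) = x * pow x n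

  fromℕ : ℕ → Carrier
  fromℕ zero    = 0#
  fromℕ (suc n) = 1# + fromℕ n

  Σ< : ℕ → (ℕ → Carrier) → Carrier
  Σ< zero    f = 0#
  Σ< (suc N) f = Σ< N f + f N

  sumList : List Carrier → Carrier
  sumList = foldr _+_ 0#

  weight : List ℕ → Filling → Carrier
  weight λ′ T = pow q (wt λ′ T) * (pow α⁻¹ (fStat λ′ T) * pow β⁻¹ (uStat λ′ T))

  F : List ℕ → Carrier
  F λ′ = sumList (map (λ T → if isPermTableau λ′ T then weight λ′ T else 0#) (fillingsOf λ′))

  Fexp : ℕ → Carrier
  Fexp N = sumList (map F (partitionsOfExpanse N))

  -- infinite matrices, 0-indexed (index i here = index i+1 in the paper)
  Mat : Set c
  Mat = ℕ → ℕ → Carrier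

  D₁ : Mat
  D₁ i j = if j ≡ᵇ suc i then β⁻¹ else 0#

  E₁ : Mat
  E₁ i j = if j ≤ᵇ i
           then pow β (i ∸ j) * (α⁻¹ * pow q j * fromℕ (i C j)
                                 + Σ< j (λ r → fromℕ ((i ∸ j ℕ.+ r) C r) * pow q r))
           else 0#

  _+ᴹ_ : Mat → Mat → Mat
  (M +ᴹ N) i j = M i j + N i j

  -- row vector v (supported on indices < N) times matrix M, exact:
  rowMul : ℕ → (ℕ → Carrier) → Mat → (ℕ → Carrier)
  rowMul N v M j = Σ< N (λ i → v i * M i j)

  -- v M₁ M₂ ⋯ Mₙ, tracking the support bound (each of D₁, E₁, D₁+E₁ has
  -- M i j = 0 for j > i+1, so the support grows by at most one per factor)
  rowProd : ℕ → (ℕ → Carrier) → List Mat → (ℕ → Carrier)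
  rowProd N v []       = v
  rowProd N v (M ∷ Ms) = rowProd (suc N) (rowMul N v M) Ms

  W₁ : ℕ → Carrier
  W₁ i = if i ≡ᵇ 0 then 1# else 0#

  -- W₁ M₁ ⋯ Mₙ V₁ = sum of the entries of the top row of the product
  WMV : List Mat → Carrier
  WMV Ms = Σ< (suc (length Ms)) (rowProd 1 W₁ Ms)

  -- τ D₁ + (1 − τ) E₁ for τ ∈ {0,1}
  factor : Bool → Mat
  factor true  = D₁
  factor false = E₁

{-# OPTIONS --safe #-}
module Submission where

-- Every partition with at least one row arises from the partition (0) by appending empty bottom rows and
-- adding full first columns, and φ records these steps: a new row appends S, a new column appends W.
-- Replace β⁻¹^u by y(u + 1) for an arbitrary y : ℕ → R, where u + 1 is the number of unrestricted rows.
-- An empty bottom row is unrestricted, so appending it just shifts y. Summing over the 0/1 fillings of a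
-- new first column turns y into E₀ y, a combination of binomial sums: a 1 in that column lies to the left
-- of its whole row, so it may only sit in a row that was unrestricted, and it restricts the rows below it
-- that receive a 0. Hence F_λ = (M₁ ⋯ Mₙ y)₀ with Mᵢ ∈ {D₀, E₀}, and conjugating by diag(β^j) turns D₀, E₀
-- into D₁, E₁ and y into V₁. Summing over all λ gives the second identity, since φ is a bijection onto
-- {S,W}ⁿ and the product is multilinear in its factors.

open import Algebra.Bundles using (CommutativeRing)
import Algebra.Properties.CommutativeSemigroup as CommutativeSemigroupProperties
open import Data.Bool using (Bool; true; false; not; _∧_; _∨_; if_then_else_)
import Data.Bool.Properties as 𝔹
open import Data.Bool.ListAction using (any; all; and; or)
open import Data.Empty using (⊥-elim)
open import Data.List using (List; []; _∷_; _++_; _∷ʳ_; map; foldr; concatMap; upTo; length; replicate; tail)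
import Data.List.Properties as List
open import Data.List.Relation.Unary.All using (All; []; _∷_)
open import Data.List.Relation.Unary.Linked using (Linked; [-]; _∷_)
open import Data.Maybe using (Maybe; just; nothing; maybe)
import Data.Nat as Nat
open Nat using (ℕ; zero; suc; _∸_; _≤_; _<_; _≥_; z≤n; s≤s)
open import Data.Nat.Combinatorics using (_C_; nCk+nC[k+1]≡[n+1]C[k+1]; k>n⇒nCk≡0)
import Data.Nat.Properties as ℕ
open import Data.Product using (_×_; _,_)
open import Function using (id; _∘_)
open import Level using (Level)
open import Relation.Binary.PropositionalEquality using (_≡_; _≢_; _≗_; refl; sym; trans; cong; cong₂; subst)
open import Relation.Nullary using (yes; no; proof; ofʸ; ofⁿ)

open import Defs

open CommutativeSemigroupProperties ℕ.+-commutativeSemigroup using () renaming (interchange to ℕ-+-interchange)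

not-∨ : ∀ a b → not (a ∨ b) ≡ not a ∧ not b
not-∨ true  b = refl
not-∨ false b = refl

fromBool : Bool → ℕ
fromBool true  = 1
fromBool false = 0

∧-true : ∀ {a b} → a ∧ b ≡ true → a ≡ true × b ≡ true
∧-true {true} {true} _ = refl , refl

≡ᵇ-refl : ∀ n → (n Nat.≡ᵇ n) ≡ true
≡ᵇ-refl zero    = refl
≡ᵇ-refl (suc n) = ≡ᵇ-refl n

≢⇒≡ᵇ-false : ∀ {m n} → m ≢ n → (m Nat.≡ᵇ n) ≡ false
≢⇒≡ᵇ-false {m} {n} m≢n with m Nat.≡ᵇ n | proof (m ℕ.≟ n)
... | false | _       = refl
... | true  | ofʸ m≡n = ⊥-elim (m≢n m≡n)

≤⇒≤ᵇ-true : ∀ {m n} → m ≤ n → (m Nat.≤ᵇ n) ≡ true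
≤⇒≤ᵇ-true {m} {n} m≤n with m Nat.≤ᵇ n | ℕ.≤ᵇ-reflects-≤ m n
... | true  | _       = refl
... | false | ofⁿ m≰n = ⊥-elim (m≰n m≤n)

>⇒≤ᵇ-false : ∀ {m n} → n < m → (m Nat.≤ᵇ n) ≡ false
>⇒≤ᵇ-false {m} {n} n<m with m Nat.≤ᵇ n | ℕ.≤ᵇ-reflects-≤ m n
... | false | _       = refl
... | true  | ofʸ m≤n = ⊥-elim (ℕ.<⇒≱ n<m m≤n)

module _ {A : Set} where

  any-cong : ∀ {p p′ : A → Bool} → p ≗ p′ → any p ≗ any p′
  any-cong eq = cong or ∘ List.map-cong eq

  all-cong : ∀ {p p′ : A → Bool} → p ≗ p′ → all p ≗ all p′
  all-cong eq = cong and ∘ List.map-cong eq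

  any-map : ∀ (p : A → Bool) (f : ℕ → A) xs → any p (map f xs) ≡ any (p ∘ f) xs
  any-map p f xs = cong or (sym (List.map-∘ xs))

  all-map : ∀ (p : A → Bool) (f : ℕ → A) xs → all p (map f xs) ≡ all (p ∘ f) xs
  all-map p f xs = cong and (sym (List.map-∘ xs))

  any-++ : ∀ (p : A → Bool) xs ys → any p (xs ++ ys) ≡ any p xs ∨ any p ys
  any-++ p []       ys = refl
  any-++ p (x ∷ xs) ys = trans (cong (p x ∨_) (any-++ p xs ys)) (sym (𝔹.∨-assoc (p x) _ _))

  all-++ : ∀ (p : A → Bool) xs ys → all p (xs ++ ys) ≡ all p xs ∧ all p ys
  all-++ p []       ys = refl
  all-++ p (x ∷ xs) ys = trans (cong (p x ∧_) (all-++ p xs ys)) (sym (𝔹.∧-assoc (p x) _ _))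

  any-false : ∀ xs → any (λ (_ : A) → false) xs ≡ false
  any-false []       = refl
  any-false (_ ∷ xs) = any-false xs

  all-true : ∀ xs → all (λ (_ : A) → true) xs ≡ true
  all-true []       = refl
  all-true (_ ∷ xs) = all-true xs

  all-∧ : ∀ (p p′ : A → Bool) xs → all (λ x → p x ∧ p′ x) xs ≡ all p xs ∧ all p′ xs
  all-∧ p p′ []       = refl
  all-∧ p p′ (x ∷ xs) with p x | p′ x
  ... | true  | true  = all-∧ p p′ xs
  ... | true  | false = sym (𝔹.∧-zeroʳ (all p xs))
  ... | false | _     = refl

  all-∨ˡ : ∀ b (p : A → Bool) xs → all (λ x → b ∨ p x) xs ≡ b ∨ all p xs
  all-∨ˡ true  p xs = all-true xs
  all-∨ˡ false p xs = refl

  not-any : ∀ (p : A → Bool) xs → not (any p xs) ≡ all (not ∘ p) xs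
  not-any p []       = refl
  not-any p (x ∷ xs) with p x
  ... | true  = refl
  ... | false = not-any p xs

countList : (ℕ → Bool) → List ℕ → ℕ
countList p = foldr (λ i acc → if p i then suc acc else acc) 0

sumOver : (ℕ → ℕ) → List ℕ → ℕ
sumOver g = foldr (λ i acc → g i Nat.+ acc) 0

countList-cong : ∀ {p p′} → p ≗ p′ → countList p ≗ countList p′
countList-cong eq []       = refl
countList-cong eq (x ∷ xs) = cong₂ (λ b n → if b then suc n else n) (eq x) (countList-cong eq xs)

countList-map : ∀ p (f : ℕ → ℕ) xs → countList p (map f xs) ≡ countList (p ∘ f) xs
countList-map p f []       = refl
countList-map p f (x ∷ xs) = cong (λ n → if p (f x) then suc n else n) (countList-map p f xs)

countList-++ : ∀ p xs ys → countList p (xs ++ ys) ≡ countList p xs Nat.+ countList p ys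
countList-++ p []       ys = refl
countList-++ p (x ∷ xs) ys with p x
... | true  = cong suc (countList-++ p xs ys)
... | false = countList-++ p xs ys

countList≡sumOver : ∀ p xs → countList p xs ≡ sumOver (fromBool ∘ p) xs
countList≡sumOver p []       = refl
countList≡sumOver p (x ∷ xs) with p x
... | true  = cong suc (countList≡sumOver p xs)
... | false = countList≡sumOver p xs

sumOver-cong : ∀ {g g′} → g ≗ g′ → sumOver g ≗ sumOver g′
sumOver-cong eq []       = refl
sumOver-cong eq (x ∷ xs) = cong₂ Nat._+_ (eq x) (sumOver-cong eq xs)

sumOver-+ : ∀ f g xs → sumOver (λ i → f i Nat.+ g i) xs ≡ sumOver f xs Nat.+ sumOver g xs
sumOver-+ f g []       = refl
sumOver-+ f g (x ∷ xs) = trans (cong ((f x Nat.+ g x) Nat.+_) (sumOver-+ f g xs)) (ℕ-+-interchange (f x) (g x) _ _)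

sumOver-++ : ∀ g xs ys → sumOver g (xs ++ ys) ≡ sumOver g xs Nat.+ sumOver g ys
sumOver-++ g []       ys = refl
sumOver-++ g (x ∷ xs) ys = trans (cong (g x Nat.+_) (sumOver-++ g xs ys)) (sym (ℕ.+-assoc (g x) _ _))

upTo-suc : ∀ n → upTo (suc n) ≡ 0 ∷ map suc (upTo n)
upTo-suc n = cong (0 ∷_) (sym (List.map-upTo suc n))

any-upTo-suc : ∀ p n → any p (upTo (suc n)) ≡ p 0 ∨ any (p ∘ suc) (upTo n)
any-upTo-suc p n = trans (cong (any p) (upTo-suc n)) (cong (p 0 ∨_) (any-map p suc (upTo n)))

all-upTo-suc : ∀ p n → all p (upTo (suc n)) ≡ p 0 ∧ all (p ∘ suc) (upTo n)
all-upTo-suc p n = trans (cong (all p) (upTo-suc n)) (cong (p 0 ∧_) (all-map p suc (upTo n)))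

count-suc : ∀ n p → count (suc n) p ≡ fromBool (p 0) Nat.+ count n (p ∘ suc)
count-suc n p = trans (cong (countList p) (upTo-suc n)) (tally (p 0) (countList-map p suc (upTo n)))
  where
  tally : ∀ b {a c} → a ≡ c → (if b then suc a else a) ≡ fromBool b Nat.+ c
  tally true  refl = refl
  tally false refl = refl

any-upTo-∷ʳ : ∀ p n → any p (upTo (suc n)) ≡ any p (upTo n) ∨ p n
any-upTo-∷ʳ p n = trans (cong (any p) (sym (List.upTo-∷ʳ n)))
  (trans (any-++ p (upTo n) (n ∷ [])) (cong (any p (upTo n) ∨_) (𝔹.∨-identityʳ (p n))))

all-upTo-∷ʳ : ∀ p n → all p (upTo (suc n)) ≡ all p (upTo n) ∧ p n
all-upTo-∷ʳ p n = trans (cong (all p) (sym (List.upTo-∷ʳ n)))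
  (trans (all-++ p (upTo n) (n ∷ [])) (cong (all p (upTo n) ∧_) (𝔹.∧-identityʳ (p n))))

count-∷ʳ : ∀ n p → count (suc n) p ≡ count n p Nat.+ fromBool (p n)
count-∷ʳ n p = trans (cong (countList p) (sym (List.upTo-∷ʳ n)))
  (trans (countList-++ p (upTo n) (n ∷ [])) (cong (count n p Nat.+_) (if≡fromBool (p n))))
  where
  if≡fromBool : ∀ b → (if b then 1 else 0) ≡ fromBool b
  if≡fromBool true  = refl
  if≡fromBool false = refl

sumOver-upTo-∷ʳ : ∀ n g → sumOver g (upTo (suc n)) ≡ sumOver g (upTo n) Nat.+ (g n Nat.+ 0)
sumOver-upTo-∷ʳ n g = trans (cong (sumOver g) (sym (List.upTo-∷ʳ n))) (sumOver-++ g (upTo n) (n ∷ []))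

count-false : ∀ n → count n (λ _ → false) ≡ 0
count-false n = countList-false (upTo n)
  where
  countList-false : ∀ xs → countList (λ _ → false) xs ≡ 0
  countList-false []       = refl
  countList-false (_ ∷ xs) = countList-false xs

1≤count : ∀ n p → any p (upTo n) ≡ true → 1 ≤ count n p
1≤count (suc n) p h with p 0 | trans (sym (any-upTo-suc p n)) h | count-suc n p
... | true  | _  | eq = ℕ.≤-trans (s≤s z≤n) (ℕ.≤-reflexive (sym eq))
... | false | h′ | eq = ℕ.≤-trans (1≤count n (p ∘ suc) h′) (ℕ.≤-reflexive (sym eq))

-- For e = ent T they
-- are Defs' own (F≡F′ is refl); abstracting over e lets a bottom row be dropped or a first column split off.
module Statistics (k m : ℕ) (e : ℕ → ℕ → Maybe Bool) where

  hasOne hasZero : ℕ → ℕ → Bool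
  hasOne  i j = maybe id false (e i j)
  hasZero i j = maybe not false (e i j)

  oneAbove oneLeft : ℕ → ℕ → Bool
  oneAbove i j = any (λ i′ → hasOne i′ j) (upTo i)
  oneLeft  i j = any (λ j′ → hasOne i j′) (upTo j)

  columnsHaveOnes : Bool
  columnsHaveOnes = all (λ j → any (λ i → hasOne i j) (upTo k)) (upTo m)

  allowedAt : ℕ → ℕ → Bool
  allowedAt i j = not (hasZero i j ∧ oneAbove i j ∧ oneLeft i j)

  rowAllowed : ℕ → Bool
  rowAllowed i = all (allowedAt i) (upTo m)

  noForbiddenZeros : Bool
  noForbiddenZeros = all rowAllowed (upTo k)

  isTableau : Bool
  isTableau = columnsHaveOnes ∧ noForbiddenZeros

  restrictedAt : ℕ → ℕ → Bool
  restrictedAt i j = hasZero i j ∧ oneAbove i j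

  unrestricted : ℕ → Bool
  unrestricted i = not (any (restrictedAt i) (upTo m))

  ones topOnes unrestrictedRows : ℕ
  ones             = sumOver (λ i → count m (hasOne i)) (upTo k)
  topOnes          = count m (hasOne 0)
  unrestrictedRows = count k unrestricted

module _ (k m : ℕ) {e e′ : ℕ → ℕ → Maybe Bool} (e≗e′ : ∀ i j → e i j ≡ e′ i j) where
  private
    module S  = Statistics k m e
    module S′ = Statistics k m e′

    hasOne≡ : ∀ i j → S.hasOne i j ≡ S′.hasOne i j
    hasOne≡ i j = cong (maybe id false) (e≗e′ i j)

    hasZero≡ : ∀ i j → S.hasZero i j ≡ S′.hasZero i j
    hasZero≡ i j = cong (maybe not false) (e≗e′ i j)

    oneAbove≡ : ∀ i j → S.oneAbove i j ≡ S′.oneAbove i j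
    oneAbove≡ i j = any-cong (λ i′ → hasOne≡ i′ j) (upTo i)

  isTableau-cong : S.isTableau ≡ S′.isTableau
  isTableau-cong = cong₂ _∧_
    (all-cong (λ j → any-cong (λ i → hasOne≡ i j) (upTo k)) (upTo m))
    (all-cong (λ i → all-cong (λ j → cong not (cong₂ _∧_ (hasZero≡ i j)
      (cong₂ _∧_ (oneAbove≡ i j) (any-cong (hasOne≡ i) (upTo j))))) (upTo m)) (upTo k))

  ones-cong : S.ones ≡ S′.ones
  ones-cong = sumOver-cong (λ i → countList-cong (hasOne≡ i) (upTo m)) (upTo k)

  topOnes-cong : S.topOnes ≡ S′.topOnes
  topOnes-cong = countList-cong (hasOne≡ 0) (upTo m)

  unrestrictedRows-cong : S.unrestrictedRows ≡ S′.unrestrictedRows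
  unrestrictedRows-cong = countList-cong
    (λ i → cong not (any-cong (λ j → cong₂ _∧_ (hasZero≡ i j) (oneAbove≡ i j)) (upTo m))) (upTo k)

unrestricted-top : ∀ k m e → Statistics.unrestricted k m e 0 ≡ true
unrestricted-top k m e =
  cong not (trans (any-cong (λ j → 𝔹.∧-zeroʳ (Statistics.hasZero k m e 0 j)) (upTo m)) (any-false (upTo m)))

module EmptyLastRow (k m : ℕ) (e : ℕ → ℕ → Maybe Bool) (empty : ∀ j → e k j ≡ nothing) where
  private
    module S  = Statistics (suc k) m e
    module S′ = Statistics k m e

    noOne : ∀ j → S.hasOne k j ≡ false
    noOne j rewrite empty j = refl

    noZero : ∀ j → S.hasZero k j ≡ false
    noZero j rewrite empty j = refl

  isTableau≡ : S.isTableau ≡ S′.isTableau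
  isTableau≡ = cong₂ _∧_
    (all-cong (λ j → trans (any-upTo-∷ʳ (λ i → S.hasOne i j) k)
                     (trans (cong (any (λ i → S.hasOne i j) (upTo k) ∨_) (noOne j)) (𝔹.∨-identityʳ _))) (upTo m))
    (trans (all-upTo-∷ʳ S.rowAllowed k)
      (trans (cong (S′.noForbiddenZeros ∧_)
               (trans (all-cong (λ j → cong (λ z → not (z ∧ S.oneAbove k j ∧ S.oneLeft k j)) (noZero j)) (upTo m))
                      (all-true (upTo m))))
             (𝔹.∧-identityʳ _)))

  ones≡ : S.ones ≡ S′.ones
  ones≡ = trans (sumOver-upTo-∷ʳ k (λ i → count m (S.hasOne i)))
    (trans (cong (λ z → S′.ones Nat.+ (z Nat.+ 0)) (trans (countList-cong noOne (upTo m)) (count-false m)))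
           (ℕ.+-identityʳ _))

  unrestrictedRows≡ : S.unrestrictedRows ≡ suc S′.unrestrictedRows
  unrestrictedRows≡ = trans (count-∷ʳ k S.unrestricted)
    (trans (cong (λ b → S′.unrestrictedRows Nat.+ fromBool b) lastRow) (ℕ.+-comm S′.unrestrictedRows 1))
    where
    lastRow : S.unrestricted k ≡ true
    lastRow = cong not (trans (any-cong (λ j → cong (_∧ S.oneAbove k j) (noZero j)) (upTo m)) (any-false (upTo m)))

module FirstColumn (k m : ℕ) (e : ℕ → ℕ → Maybe Bool) where
  private
    module S  = Statistics k (suc m) e
    module S′ = Statistics k m (λ i j → e i (suc j))

  firstOne firstZero : ℕ → Bool
  firstOne  i = S.hasOne i 0
  firstZero i = S.hasZero i 0

  columnsHaveOnes≡ : S.columnsHaveOnes ≡ any firstOne (upTo k) ∧ S′.columnsHaveOnes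
  columnsHaveOnes≡ = all-upTo-suc _ m

  -- A 1 in the first column lies to the left of every later entry of its row, so that row must be unrestricted.
  noForbiddenZeros≡ : S.noForbiddenZeros
                    ≡ all (λ i → not (firstOne i) ∨ S′.unrestricted i) (upTo k) ∧ S′.noForbiddenZeros
  noForbiddenZeros≡ = trans (all-cong row (upTo k)) (all-∧ _ S′.rowAllowed (upTo k))
    where
    firstCell : ∀ z a → not (z ∧ a ∧ false) ≡ true
    firstCell true  true  = refl
    firstCell true  false = refl
    firstCell false a     = refl

    laterCell : ∀ z a b l → not (z ∧ a ∧ (b ∨ l)) ≡ (not b ∨ not (z ∧ a)) ∧ not (z ∧ a ∧ l)
    laterCell true  true  true  l = refl
    laterCell true  true  false l = refl
    laterCell true  false true  l = refl
    laterCell true  false false l = refl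
    laterCell false a     true  l = refl
    laterCell false a     false l = refl

    row : ∀ i → S.rowAllowed i ≡ (not (firstOne i) ∨ S′.unrestricted i) ∧ S′.rowAllowed i
    row i = trans (all-upTo-suc (S.allowedAt i) m)
      (trans (cong₂ _∧_ (firstCell (S.hasZero i 0) (S.oneAbove i 0))
               (all-cong (λ j → trans (cong (λ z → not (S′.hasZero i j ∧ S′.oneAbove i j ∧ z))
                                              (any-upTo-suc (S.hasOne i) j))
                                      (laterCell (S′.hasZero i j) (S′.oneAbove i j) (firstOne i) (S′.oneLeft i j)))
                        (upTo m)))
      (trans (all-∧ (λ j → not (firstOne i) ∨ not (S′.restrictedAt i j)) (S′.allowedAt i) (upTo m))
        (cong (_∧ S′.rowAllowed i) (trans (all-∨ˡ (not (firstOne i)) (not ∘ S′.restrictedAt i) (upTo m))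
                                          (cong (not (firstOne i) ∨_) (sym (not-any (S′.restrictedAt i) (upTo m))))))))

  unrestricted≡ : ∀ i → S.unrestricted i ≡ not (firstZero i ∧ any firstOne (upTo i)) ∧ S′.unrestricted i
  unrestricted≡ i = trans (cong not (any-upTo-suc (S.restrictedAt i) m))
                          (not-∨ (S.restrictedAt i 0) (any (S.restrictedAt i ∘ suc) (upTo m)))

  ones≡ : S.ones ≡ count k firstOne Nat.+ S′.ones
  ones≡ = trans (sumOver-cong (λ i → count-suc m (S.hasOne i)) (upTo k))
    (trans (sumOver-+ (fromBool ∘ firstOne) (λ i → count m (S′.hasOne i)) (upTo k))
           (cong (Nat._+ S′.ones) (sym (countList≡sumOver firstOne (upTo k)))))

  topOnes≡ : S.topOnes ≡ fromBool (firstOne 0) Nat.+ S′.topOnes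
  topOnes≡ = count-suc m (S.hasOne 0)

  unrestrictedRows≡ : S.unrestrictedRows
                    ≡ count k (λ i → not (firstZero i ∧ any firstOne (upTo i)) ∧ S′.unrestricted i)
  unrestrictedRows≡ = countList-cong unrestricted≡ (upTo k)

-- wt is a truncated subtraction; this bound makes it the true number of 1's minus m.
ones≥columns : ∀ k m e → Statistics.columnsHaveOnes k m e ≡ true → m ≤ Statistics.ones k m e
ones≥columns k zero    e _ = z≤n
ones≥columns k (suc m) e h
  with ∧-true (trans (sym (FirstColumn.columnsHaveOnes≡ k m e)) h)
... | first , rest = ℕ.≤-trans
  (ℕ.+-mono-≤ (1≤count k (FirstColumn.firstOne k m e) first) (ones≥columns k m (λ i j → e i (suc j)) rest))
  (ℕ.≤-reflexive (sym (FirstColumn.ones≡ k m e)))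

ent-∷ : ∀ (r : List Bool) T i j → ent (r ∷ T) (suc i) j ≡ ent T i j
ent-∷ r T i j with at T i
... | nothing = refl
... | just _  = refl

ent-∷ʳ[] : ∀ (T : Filling) i j → ent (T ∷ʳ []) i j ≡ ent T i j
ent-∷ʳ[] []      zero    j = refl
ent-∷ʳ[] []      (suc i) j = refl
ent-∷ʳ[] (r ∷ T) zero    j = refl
ent-∷ʳ[] (r ∷ T) (suc i) j = trans (ent-∷ r (T ∷ʳ []) i j) (trans (ent-∷ʳ[] T i j) (sym (ent-∷ r T i j)))

ent-length : ∀ (T : Filling) j → ent T (length T) j ≡ nothing
ent-length []      j = refl
ent-length (r ∷ T) j = trans (ent-∷ r T (length T) j) (ent-length T j)

consColumn : List Bool → Filling → Filling
consColumn (b ∷ c) (r ∷ T) = (b ∷ r) ∷ consColumn c T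
consColumn _       _       = []

withColumn : List Bool → (ℕ → ℕ → Maybe Bool) → ℕ → ℕ → Maybe Bool
withColumn c e i zero    = at c i
withColumn c e i (suc j) = e i j

ent-consColumn : ∀ c T → length c ≡ length T → ∀ i j → ent (consColumn c T) i j ≡ withColumn c (ent T) i j
ent-consColumn []      []      _ i       zero    = refl
ent-consColumn []      []      _ i       (suc j) = refl
ent-consColumn (b ∷ c) (r ∷ T) _ zero    zero    = refl
ent-consColumn (b ∷ c) (r ∷ T) _ zero    (suc j) = refl
ent-consColumn (b ∷ c) (r ∷ T) h (suc i) zero    =
  trans (ent-∷ (b ∷ r) (consColumn c T) i zero) (ent-consColumn c T (ℕ.suc-injective h) i zero)
ent-consColumn (b ∷ c) (r ∷ T) h (suc i) (suc j) =
  trans (ent-∷ (b ∷ r) (consColumn c T) i (suc j))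
    (trans (ent-consColumn c T (ℕ.suc-injective h) i (suc j)) (sym (ent-∷ r T i j)))

oneAt zeroAt : List Bool → ℕ → Bool
oneAt  c i = maybe id false (at c i)
zeroAt c i = maybe not false (at c i)

-- For a new first column c next to a filling whose unrestricted rows are U: onesAllowed says every 1 of c is
-- in such a row, and stillUnrestricted counts the rows of U that stay unrestricted, where `seen` records a 1
-- of the column above row 0.
onesAllowed : ℕ → List Bool → (ℕ → Bool) → Bool
onesAllowed k c U = all (λ i → not (oneAt c i) ∨ U i) (upTo k)

stillUnrestricted : ℕ → Bool → List Bool → (ℕ → Bool) → ℕ
stillUnrestricted k seen c U = count k (λ i → not (zeroAt c i ∧ (seen ∨ any (oneAt c) (upTo i))) ∧ U i)

onesAllowed-∷ : ∀ k b c U → onesAllowed (suc k) (b ∷ c) U ≡ (not b ∨ U 0) ∧ onesAllowed k c (U ∘ suc)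
onesAllowed-∷ k b c U = all-upTo-suc _ k

any-oneAt-∷ : ∀ k b c → any (oneAt (b ∷ c)) (upTo (suc k)) ≡ b ∨ any (oneAt c) (upTo k)
any-oneAt-∷ k b c = any-upTo-suc _ k

count-oneAt-∷ : ∀ k b c → count (suc k) (oneAt (b ∷ c)) ≡ fromBool b Nat.+ count k (oneAt c)
count-oneAt-∷ k b c = count-suc k _

stillUnrestricted-∷ : ∀ k seen b c U → stillUnrestricted (suc k) seen (b ∷ c) U
  ≡ fromBool (not (not b ∧ (seen ∨ false)) ∧ U 0) Nat.+ stillUnrestricted k (seen ∨ b) c (U ∘ suc)
stillUnrestricted-∷ k seen b c U = trans (count-suc k _)
  (cong (fromBool (not (not b ∧ (seen ∨ false)) ∧ U 0) Nat.+_)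
    (countList-cong (λ i → cong (λ z → not (zeroAt c i ∧ z) ∧ U (suc i))
      (trans (cong (seen ∨_) (any-upTo-suc (oneAt (b ∷ c)) i)) (sym (𝔹.∨-assoc seen b _)))) (upTo k)))

data Shape : List ℕ → Set where
  single      : Shape (0 ∷ [])
  addEmptyRow : ∀ {a l} → Shape (a ∷ l) → Shape (a ∷ (l ∷ʳ 0))
  addColumn   : ∀ {a l} → Shape (a ∷ l) → Shape (suc a ∷ map suc l)

rowShape : ∀ a → Shape (a ∷ [])
rowShape zero    = single
rowShape (suc a) = addColumn (rowShape a)

addTopRow : ∀ {a b l} → b ≤ a → Shape (b ∷ l) → Shape (a ∷ b ∷ l)
addTopRow {a} _ single          = addEmptyRow (rowShape a)
addTopRow b≤a   (addEmptyRow s) = addEmptyRow (addTopRow b≤a s)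
addTopRow (s≤s b≤a) (addColumn s) = addColumn (addTopRow b≤a s)

shape : ∀ a l → Linked _≥_ (a ∷ l) → Shape (a ∷ l)
shape a []      _          = rowShape a
shape a (b ∷ l) (b≤a ∷ bl) = addTopRow b≤a (shape b l bl)

φ-cons : ∀ a l → φ (a ∷ l) ≡ boundaryFrom a l
φ-cons a l = cong (λ z → maybe id [] (tail (replicate z false ++ true ∷ boundaryFrom a l))) (ℕ.n∸n≡0 a)

φ-addEmptyRow : ∀ a l → φ (a ∷ (l ∷ʳ 0)) ≡ φ (a ∷ l) ∷ʳ true
φ-addEmptyRow a l = trans (φ-cons a (l ∷ʳ 0)) (trans (boundary-∷ʳ0 a l) (cong (_∷ʳ true) (sym (φ-cons a l))))
  where
  boundary-∷ʳ0 : ∀ p l → boundaryFrom p (l ∷ʳ 0) ≡ boundaryFrom p l ∷ʳ true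
  boundary-∷ʳ0 p []      = refl
  boundary-∷ʳ0 p (b ∷ l) = trans (cong (λ w → replicate (p ∸ b) false ++ true ∷ w) (boundary-∷ʳ0 b l))
                                 (sym (List.++-assoc (replicate (p ∸ b) false) (true ∷ boundaryFrom b l) _))

φ-addColumn : ∀ a l → φ (suc a ∷ map suc l) ≡ φ (a ∷ l) ∷ʳ false
φ-addColumn a l = trans (φ-cons (suc a) (map suc l)) (trans (boundary-suc a l) (cong (_∷ʳ false) (sym (φ-cons a l))))
  where
  replicate-suc : ∀ p → replicate (suc p) false ≡ replicate p false ∷ʳ false
  replicate-suc zero    = refl
  replicate-suc (suc p) = cong (false ∷_) (replicate-suc p)

  boundary-suc : ∀ p l → boundaryFrom (suc p) (map suc l) ≡ boundaryFrom p l ∷ʳ false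
  boundary-suc p []      = replicate-suc p
  boundary-suc p (b ∷ l) = trans (cong (λ w → replicate (p ∸ b) false ++ true ∷ w) (boundary-suc b l))
                                 (sym (List.++-assoc (replicate (p ∸ b) false) (true ∷ boundaryFrom b l) _))

module _ {c ℓ : Level} (R : CommutativeRing c ℓ) (q α⁻¹ β β⁻¹ : CommutativeRing.Carrier R) where
  open CommutativeRing R renaming (refl to ≈-refl; sym to ≈-sym; trans to ≈-trans)
  open WithRing R q α⁻¹ β β⁻¹
  open CommutativeSemigroupProperties +-commutativeSemigroup using ()
    renaming (interchange to +-interchange; x∙yz≈y∙xz to +-leftCommute)
  open CommutativeSemigroupProperties *-commutativeSemigroup using ()
    renaming (interchange to *-interchange; x∙yz≈y∙xz to *-leftCommute)
  import Algebra.Solver.CommutativeMonoid *-commutativeMonoid as *-Solver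
  open *-Solver using (_⊕_; _⊜_)
  open import Relation.Binary.Reasoning.Setoid setoid

  Σ<-cong : ∀ N {f g : ℕ → Carrier} → (∀ i → f i ≈ g i) → Σ< N f ≈ Σ< N g
  Σ<-cong zero    eq = ≈-refl
  Σ<-cong (suc N) eq = +-cong (Σ<-cong N eq) (eq N)

  Σ<-cong-< : ∀ N {f g : ℕ → Carrier} → (∀ i → i < N → f i ≈ g i) → Σ< N f ≈ Σ< N g
  Σ<-cong-< zero    eq = ≈-refl
  Σ<-cong-< (suc N) eq = +-cong (Σ<-cong-< N (λ i i<N → eq i (ℕ.m<n⇒m<1+n i<N))) (eq N ℕ.≤-refl)

  Σ<-zero : ∀ N {f : ℕ → Carrier} → (∀ i → i < N → f i ≈ 0#) → Σ< N f ≈ 0#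
  Σ<-zero zero    eq = ≈-refl
  Σ<-zero (suc N) eq = ≈-trans (+-cong (Σ<-zero N (λ i i<N → eq i (ℕ.m<n⇒m<1+n i<N))) (eq N ℕ.≤-refl)) (+-identityʳ 0#)

  Σ<-+ : ∀ N (f g : ℕ → Carrier) → Σ< N (λ i → f i + g i) ≈ Σ< N f + Σ< N g
  Σ<-+ zero    f g = ≈-sym (+-identityʳ 0#)
  Σ<-+ (suc N) f g = ≈-trans (+-congʳ (Σ<-+ N f g)) (+-interchange _ _ _ _)

  *-distribˡ-Σ< : ∀ N a (f : ℕ → Carrier) → a * Σ< N f ≈ Σ< N (λ i → a * f i)
  *-distribˡ-Σ< zero    a f = zeroʳ a
  *-distribˡ-Σ< (suc N) a f = ≈-trans (distribˡ a _ _) (+-congʳ (*-distribˡ-Σ< N a f))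

  *-distribʳ-Σ< : ∀ N a (f : ℕ → Carrier) → Σ< N f * a ≈ Σ< N (λ i → f i * a)
  *-distribʳ-Σ< N a f = ≈-trans (*-comm _ a) (≈-trans (*-distribˡ-Σ< N a f) (Σ<-cong N (λ i → *-comm a (f i))))

  Σ<-suc : ∀ N (f : ℕ → Carrier) → Σ< (suc N) f ≈ f 0 + Σ< N (f ∘ suc)
  Σ<-suc zero    f = ≈-trans (+-identityˡ (f 0)) (≈-sym (+-identityʳ (f 0)))
  Σ<-suc (suc N) f = ≈-trans (+-congʳ (Σ<-suc N f)) (+-assoc _ _ _)

  Σ<-extend : ∀ d L {f : ℕ → Carrier} → (∀ j → L ≤ j → f j ≈ 0#) → Σ< (d Nat.+ L) f ≈ Σ< L f
  Σ<-extend zero    L eq = ≈-refl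
  Σ<-extend (suc d) L eq = ≈-trans (+-cong (Σ<-extend d L eq) (eq (d Nat.+ L) (ℕ.m≤n+m L d))) (+-identityʳ _)

  Σ<-comm : ∀ A B (f : ℕ → ℕ → Carrier) → Σ< A (λ i → Σ< B (f i)) ≈ Σ< B (λ j → Σ< A (λ i → f i j))
  Σ<-comm zero    B f = ≈-sym (Σ<-zero B (λ _ _ → ≈-refl))
  Σ<-comm (suc A) B f = ≈-trans (+-congʳ (Σ<-comm A B f)) (≈-sym (Σ<-+ B (λ j → Σ< A (λ i → f i j)) (f A)))

  sumOf : {X : Set} → List X → (X → Carrier) → Carrier
  sumOf xs f = sumList (map f xs)

  module _ {X : Set} where

    sumOf-cong : ∀ (xs : List X) {f g : X → Carrier} → (∀ x → f x ≈ g x) → sumOf xs f ≈ sumOf xs g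
    sumOf-cong []       eq = ≈-refl
    sumOf-cong (x ∷ xs) eq = +-cong (eq x) (sumOf-cong xs eq)

    sumOf-zero : ∀ (xs : List X) {f : X → Carrier} → (∀ x → f x ≈ 0#) → sumOf xs f ≈ 0#
    sumOf-zero []       eq = ≈-refl
    sumOf-zero (x ∷ xs) eq = ≈-trans (+-cong (eq x) (sumOf-zero xs eq)) (+-identityʳ 0#)

    sumOf-++ : ∀ (xs ys : List X) f → sumOf (xs ++ ys) f ≈ sumOf xs f + sumOf ys f
    sumOf-++ []       ys f = ≈-sym (+-identityˡ _)
    sumOf-++ (x ∷ xs) ys f = ≈-trans (+-congˡ (sumOf-++ xs ys f)) (≈-sym (+-assoc _ _ _))

    sumOf-+ : ∀ (xs : List X) f g → sumOf xs (λ x → f x + g x) ≈ sumOf xs f + sumOf xs g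
    sumOf-+ []       f g = ≈-sym (+-identityʳ 0#)
    sumOf-+ (x ∷ xs) f g = ≈-trans (+-congˡ (sumOf-+ xs f g)) (+-interchange _ _ _ _)

    *-distribˡ-sumOf : ∀ (xs : List X) a f → a * sumOf xs f ≈ sumOf xs (λ x → a * f x)
    *-distribˡ-sumOf []       a f = zeroʳ a
    *-distribˡ-sumOf (x ∷ xs) a f = ≈-trans (distribˡ a _ _) (+-congˡ (*-distribˡ-sumOf xs a f))

    sumOf-Σ< : ∀ (xs : List X) N (f : X → ℕ → Carrier) →
      sumOf xs (λ x → Σ< N (f x)) ≈ Σ< N (λ j → sumOf xs (λ x → f x j))
    sumOf-Σ< xs zero    f = sumOf-zero xs (λ _ → ≈-refl)
    sumOf-Σ< xs (suc N) f = ≈-trans (sumOf-+ xs (λ x → Σ< N (f x)) (λ x → f x N)) (+-congʳ (sumOf-Σ< xs N f))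

    sumOf-map : ∀ {Y : Set} (g : Y → X) (ys : List Y) f → sumOf (map g ys) f ≡ sumOf ys (f ∘ g)
    sumOf-map g ys f = cong sumList (sym (List.map-∘ ys))

    sumOf-concatMap : ∀ {Y : Set} (g : Y → List X) (ys : List Y) f →
      sumOf (concatMap g ys) f ≈ sumOf ys (λ y → sumOf (g y) f)
    sumOf-concatMap g []       f = ≈-refl
    sumOf-concatMap g (y ∷ ys) f = ≈-trans (sumOf-++ (g y) (concatMap g ys) f) (+-congˡ (sumOf-concatMap g ys f))

  sumOf-upTo-suc : ∀ n (f : ℕ → Carrier) → sumOf (upTo (suc n)) f ≈ f 0 + sumOf (upTo n) (f ∘ suc)
  sumOf-upTo-suc n f = reflexive (trans (cong (λ l → sumOf l f) (upTo-suc n)) (cong (f 0 +_) (sumOf-map suc (upTo n) f)))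

  sumOf-upTo : ∀ n (f : ℕ → Carrier) → sumOf (upTo n) f ≈ Σ< n f
  sumOf-upTo zero    f = ≈-refl
  sumOf-upTo (suc n) f = ≈-trans (sumOf-upTo-suc n f) (≈-trans (+-congˡ (sumOf-upTo n (f ∘ suc))) (≈-sym (Σ<-suc n f)))

  sumOf-upTo-cong : ∀ n {f g : ℕ → Carrier} → (∀ i → i < n → f i ≈ g i) → sumOf (upTo n) f ≈ sumOf (upTo n) g
  sumOf-upTo-cong n {f} {g} eq = ≈-trans (sumOf-upTo n f) (≈-trans (Σ<-cong-< n eq) (≈-sym (sumOf-upTo n g)))

  sumOf-boolLists-suc : ∀ k (f : List Bool → Carrier) →
    sumOf (boolLists (suc k)) f ≈ sumOf (boolLists k) (f ∘ (true ∷_)) + sumOf (boolLists k) (f ∘ (false ∷_))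
  sumOf-boolLists-suc k f = begin
    sumOf (boolLists (suc k)) f
      ≈⟨ sumOf-concatMap (λ b → map (b ∷_) (boolLists k)) (true ∷ false ∷ []) f ⟩
    sumOf (map (true ∷_) (boolLists k)) f + (sumOf (map (false ∷_) (boolLists k)) f + 0#)
      ≈⟨ +-congˡ (+-identityʳ _) ⟩
    sumOf (map (true ∷_) (boolLists k)) f + sumOf (map (false ∷_) (boolLists k)) f
      ≡⟨ cong₂ _+_ (sumOf-map (true ∷_) (boolLists k) f) (sumOf-map (false ∷_) (boolLists k) f) ⟩
    sumOf (boolLists k) (f ∘ (true ∷_)) + sumOf (boolLists k) (f ∘ (false ∷_)) ∎

  sumOf-boolLists-cong : ∀ k {f g : List Bool → Carrier} → (∀ c → length c ≡ k → f c ≈ g c) →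
    sumOf (boolLists k) f ≈ sumOf (boolLists k) g
  sumOf-boolLists-cong zero    eq = +-congʳ (eq [] refl)
  sumOf-boolLists-cong (suc k) {f} {g} eq = ≈-trans (sumOf-boolLists-suc k f) (≈-trans
    (+-cong (sumOf-boolLists-cong k (λ c h → eq (true ∷ c) (cong suc h)))
            (sumOf-boolLists-cong k (λ c h → eq (false ∷ c) (cong suc h))))
    (≈-sym (sumOf-boolLists-suc k g)))

  sumOf-fillingsOf-∷ : ∀ a l (f : Filling → Carrier) →
    sumOf (fillingsOf (a ∷ l)) f ≈ sumOf (boolLists a) (λ r → sumOf (fillingsOf l) (f ∘ (r ∷_)))
  sumOf-fillingsOf-∷ a l f = ≈-trans (sumOf-concatMap (λ r → map (r ∷_) (fillingsOf l)) (boolLists a) f)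
    (sumOf-cong (boolLists a) (λ r → reflexive (sumOf-map (r ∷_) (fillingsOf l) f)))

  sumOf-fillingsOf-cong : ∀ l {f g : Filling → Carrier} → (∀ T → length T ≡ length l → f T ≈ g T) →
    sumOf (fillingsOf l) f ≈ sumOf (fillingsOf l) g
  sumOf-fillingsOf-cong []      eq = +-congʳ (eq [] refl)
  sumOf-fillingsOf-cong (a ∷ l) {f} {g} eq = ≈-trans (sumOf-fillingsOf-∷ a l f) (≈-trans
    (sumOf-cong (boolLists a) (λ r → sumOf-fillingsOf-cong l (λ T h → eq (r ∷ T) (cong suc h))))
    (≈-sym (sumOf-fillingsOf-∷ a l g)))

  sumOf-fillingsOf-∷ʳ0 : ∀ l (f : Filling → Carrier) →
    sumOf (fillingsOf (l ∷ʳ 0)) f ≈ sumOf (fillingsOf l) (λ T → f (T ∷ʳ []))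
  sumOf-fillingsOf-∷ʳ0 []      f = ≈-trans (sumOf-fillingsOf-∷ 0 [] f) (+-identityʳ _)
  sumOf-fillingsOf-∷ʳ0 (a ∷ l) f = ≈-trans (sumOf-fillingsOf-∷ a (l ∷ʳ 0) f) (≈-trans
    (sumOf-cong (boolLists a) (λ r → sumOf-fillingsOf-∷ʳ0 l (f ∘ (r ∷_))))
    (≈-sym (sumOf-fillingsOf-∷ a l (λ T → f (T ∷ʳ [])))))

  sumOf-fillingsOf-map-suc : ∀ l (f : Filling → Carrier) →
    sumOf (fillingsOf (map suc l)) f
      ≈ sumOf (fillingsOf l) (λ T → sumOf (boolLists (length l)) (λ c → f (consColumn c T)))
  sumOf-fillingsOf-map-suc []      f = ≈-sym (+-identityʳ _)
  sumOf-fillingsOf-map-suc (a ∷ l) f = begin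
    sumOf (fillingsOf (suc a ∷ map suc l)) f
      ≈⟨ sumOf-fillingsOf-∷ (suc a) (map suc l) f ⟩
    sumOf (boolLists (suc a)) rest
      ≈⟨ sumOf-boolLists-suc a rest ⟩
    sumOf (boolLists a) (rest ∘ (true ∷_)) + sumOf (boolLists a) (rest ∘ (false ∷_))
      ≈⟨ +-cong (sumOf-cong (boolLists a) (λ r → sumOf-fillingsOf-map-suc l (f ∘ ((true ∷ r) ∷_))))
                (sumOf-cong (boolLists a) (λ r → sumOf-fillingsOf-map-suc l (f ∘ ((false ∷ r) ∷_)))) ⟩
    sumOf (boolLists a) (λ r → sumOf (fillingsOf l) (columns true r))
      + sumOf (boolLists a) (λ r → sumOf (fillingsOf l) (columns false r))
      ≈⟨ sumOf-+ (boolLists a) _ _ ⟨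
    sumOf (boolLists a) (λ r → sumOf (fillingsOf l) (columns true r) + sumOf (fillingsOf l) (columns false r))
      ≈⟨ sumOf-cong (boolLists a) (λ r → ≈-sym (sumOf-+ (fillingsOf l) (columns true r) (columns false r))) ⟩
    sumOf (boolLists a) (λ r → sumOf (fillingsOf l) (λ T → columns true r T + columns false r T))
      ≈⟨ sumOf-cong (boolLists a) (λ r → sumOf-cong (fillingsOf l) (λ T →
           ≈-sym (sumOf-boolLists-suc (length l) (λ c → f (consColumn c (r ∷ T)))))) ⟩
    sumOf (boolLists a) (λ r → sumOf (fillingsOf l) (λ T →
      sumOf (boolLists (suc (length l))) (λ c → f (consColumn c (r ∷ T)))))
      ≈⟨ sumOf-fillingsOf-∷ a l _ ⟨
    sumOf (fillingsOf (a ∷ l)) (λ T → sumOf (boolLists (length (a ∷ l))) (λ c → f (consColumn c T))) ∎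
    where
    rest : List Bool → Carrier
    rest r = sumOf (fillingsOf (map suc l)) (f ∘ (r ∷_))
    columns : Bool → List Bool → Filling → Carrier
    columns b r T = sumOf (boolLists (length l)) (λ c → f ((b ∷ r) ∷ consColumn c T))

  weightOf : ℕ → (ℕ → Carrier) → Bool → ℕ → ℕ → ℕ → Carrier
  weightOf m y ok n f u = if ok then pow q (n ∸ m) * (pow α⁻¹ f * y u) else 0#

  weightOf-cong : ∀ m y {ok ok′ n n′ f f′ u u′} → ok ≡ ok′ → n ≡ n′ → f ≡ f′ → u ≡ u′ →
    weightOf m y ok n f u ≡ weightOf m y ok′ n′ f′ u′
  weightOf-cong m y refl refl refl refl = refl

  tableauWeight : ℕ → ℕ → (ℕ → Carrier) → (ℕ → ℕ → Maybe Bool) → Carrier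
  tableauWeight k m y e = weightOf m y isTableau ones topOnes unrestrictedRows
    where open Statistics k m e

  F′ : List ℕ → (ℕ → Carrier) → Carrier
  F′ λ′ y = sumOf (fillingsOf λ′) (λ T → tableauWeight (length λ′) (firstPart λ′) y (ent T))

  F≡F′ : ∀ λ′ → F λ′ ≡ F′ λ′ (λ s → pow β⁻¹ (s ∸ 1))
  F≡F′ λ′ = refl

  tableauWeight-cong : ∀ k m y {e e′} → (∀ i j → e i j ≡ e′ i j) → tableauWeight k m y e ≡ tableauWeight k m y e′
  tableauWeight-cong k m y eq =
    weightOf-cong m y (isTableau-cong k m eq) (ones-cong k m eq) (topOnes-cong k m eq) (unrestrictedRows-cong k m eq)

  tableauWeight-emptyLastRow : ∀ k m y e → (∀ j → e k j ≡ nothing) →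
    tableauWeight (suc k) m y e ≡ tableauWeight k m (y ∘ suc) e
  tableauWeight-emptyLastRow k m y e empty =
    weightOf-cong m y isTableau≡ ones≡ (refl {x = Statistics.topOnes k m e}) unrestrictedRows≡
    where open EmptyLastRow k m e empty

  F′-addEmptyRow : ∀ a l y → F′ (a ∷ (l ∷ʳ 0)) y ≈ F′ (a ∷ l) (y ∘ suc)
  F′-addEmptyRow a l y = begin
    sumOf (fillingsOf (a ∷ (l ∷ʳ 0))) (λ T → tableauWeight (suc (length (l ∷ʳ 0))) a y (ent T))
      ≡⟨ cong (λ k → sumOf (fillingsOf (a ∷ (l ∷ʳ 0))) (λ T → tableauWeight (suc k) a y (ent T))) length-∷ʳ0 ⟩
    sumOf (fillingsOf ((a ∷ l) ∷ʳ 0)) (λ T → tableauWeight (suc K) a y (ent T))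
      ≈⟨ sumOf-fillingsOf-∷ʳ0 (a ∷ l) _ ⟩
    sumOf (fillingsOf (a ∷ l)) (λ T → tableauWeight (suc K) a y (ent (T ∷ʳ [])))
      ≈⟨ sumOf-fillingsOf-cong (a ∷ l) (λ T |T| → reflexive (lastRowEmpty T |T|)) ⟩
    F′ (a ∷ l) (y ∘ suc) ∎
    where
    K : ℕ
    K = length (a ∷ l)
    length-∷ʳ0 : length (l ∷ʳ 0) ≡ K
    length-∷ʳ0 = trans (List.length-++ l) (ℕ.+-comm (length l) 1)
    lastRowEmpty : ∀ T → length T ≡ K →
      tableauWeight (suc K) a y (ent (T ∷ʳ [])) ≡ tableauWeight K a (y ∘ suc) (ent T)
    lastRowEmpty T |T| = trans (tableauWeight-cong (suc K) a y (ent-∷ʳ[] T))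
      (tableauWeight-emptyLastRow K a y (ent T) (λ j → subst (λ i → ent T i j ≡ nothing) |T| (ent-length T j)))

  pow-+ : ∀ x a b → pow x (a Nat.+ b) ≈ pow x a * pow x b
  pow-+ x zero    b = ≈-sym (*-identityˡ _)
  pow-+ x (suc a) b = ≈-trans (*-congˡ (pow-+ x a b)) (≈-sym (*-assoc _ _ _))

  fromℕ-+ : ∀ a b → fromℕ (a Nat.+ b) ≈ fromℕ a + fromℕ b
  fromℕ-+ zero    b = ≈-sym (+-identityˡ _)
  fromℕ-+ (suc a) b = ≈-trans (+-congˡ (fromℕ-+ a b)) (≈-sym (+-assoc _ _ _))

  binomialSum : ℕ → (ℕ → Carrier) → Carrier
  binomialSum s x = Σ< (suc s) (λ j → fromℕ (s C j) * pow q j * x j)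

  tailSum : ℕ → (ℕ → Carrier) → Carrier
  tailSum s x = Σ< (suc s) (λ j → Σ< j (λ r → fromℕ ((s ∸ j Nat.+ r) C r) * pow q r) * x j)

  binomialSum-zero : ∀ x → binomialSum 0 x ≈ x 0
  binomialSum-zero x =
    ≈-trans (+-identityˡ _) (≈-trans (*-congʳ (≈-trans (*-identityʳ _) (+-identityʳ 1#))) (*-identityˡ _))

  binomialSum-suc : ∀ s x → binomialSum (suc s) x ≈ q * binomialSum s (x ∘ suc) + binomialSum s x
  binomialSum-suc s x = begin
    binomialSum (suc s) x
      ≈⟨ Σ<-suc (suc s) _ ⟩
    t₀ + Σ< (suc s) (λ j → fromℕ (suc s C suc j) * pow q (suc j) * x (suc j))
      ≈⟨ +-congˡ (≈-trans (Σ<-cong (suc s) pascal) (Σ<-+ (suc s) _ _)) ⟩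
    t₀ + (Σ< (suc s) (λ j → q * shifted j) + (Σ< s upper + upper s))
      ≈⟨ +-congˡ (+-cong (≈-sym (*-distribˡ-Σ< (suc s) q shifted)) (≈-trans (+-congˡ upper-s) (+-identityʳ _))) ⟩
    t₀ + (q * binomialSum s (x ∘ suc) + Σ< s upper)
      ≈⟨ +-leftCommute _ _ _ ⟩
    q * binomialSum s (x ∘ suc) + (t₀ + Σ< s upper)
      ≈⟨ +-congˡ (Σ<-suc s _) ⟨
    q * binomialSum s (x ∘ suc) + binomialSum s x ∎
    where
    t₀ : Carrier
    t₀ = fromℕ (s C 0) * pow q 0 * x 0
    shifted upper : ℕ → Carrier
    shifted j = fromℕ (s C j) * pow q j * x (suc j)
    upper   j = fromℕ (s C suc j) * pow q (suc j) * x (suc j)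
    upper-s : upper s ≈ 0#
    upper-s rewrite k>n⇒nCk≡0 (ℕ.n<1+n s) = ≈-trans (*-congʳ (zeroˡ _)) (zeroˡ _)
    pascal : ∀ j → fromℕ (suc s C suc j) * pow q (suc j) * x (suc j) ≈ q * shifted j + upper j
    pascal j = begin
      fromℕ (suc s C suc j) * pow q (suc j) * x (suc j)
        ≡⟨ cong (λ n → fromℕ n * pow q (suc j) * x (suc j)) (sym (nCk+nC[k+1]≡[n+1]C[k+1] s j)) ⟩
      fromℕ (s C j Nat.+ s C suc j) * pow q (suc j) * x (suc j)
        ≈⟨ ≈-trans (*-congʳ (≈-trans (*-congʳ (fromℕ-+ (s C j) (s C suc j))) (distribʳ _ _ _))) (distribʳ _ _ _) ⟩
      fromℕ (s C j) * (q * pow q j) * x (suc j) + upper j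
        ≈⟨ +-congʳ (≈-trans (*-congʳ (*-leftCommute _ q _)) (*-assoc q _ _)) ⟩
      q * shifted j + upper j ∎

  tailSum-zero : ∀ x → tailSum 0 x ≈ 0#
  tailSum-zero x = ≈-trans (+-identityˡ _) (zeroˡ _)

  tailSum-suc : ∀ s x → tailSum (suc s) x ≈ binomialSum s (x ∘ suc) + tailSum s (x ∘ suc)
  tailSum-suc s x = begin
    tailSum (suc s) x
      ≈⟨ Σ<-suc (suc s) _ ⟩
    0# * x 0 + Σ< (suc s) (λ j → Σ< (suc j) (coeff j) * x (suc j))
      ≈⟨ ≈-trans (+-congʳ (zeroˡ (x 0))) (+-identityˡ _) ⟩
    Σ< (suc s) (λ j → Σ< (suc j) (coeff j) * x (suc j))
      ≈⟨ Σ<-cong-< (suc s) split ⟩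
    Σ< (suc s) (λ j → fromℕ (s C j) * pow q j * x (suc j) + Σ< j (coeff j) * x (suc j))
      ≈⟨ Σ<-+ (suc s) _ _ ⟩
    binomialSum s (x ∘ suc) + tailSum s (x ∘ suc) ∎
    where
    coeff : ℕ → ℕ → Carrier
    coeff j r = fromℕ ((s ∸ j Nat.+ r) C r) * pow q r
    split : ∀ j → j < suc s →
      Σ< (suc j) (coeff j) * x (suc j) ≈ fromℕ (s C j) * pow q j * x (suc j) + Σ< j (coeff j) * x (suc j)
    split j j≤s = ≈-trans (distribʳ _ _ _) (≈-trans (+-comm _ _)
      (+-congʳ (reflexive (cong (λ n → fromℕ (n C j) * pow q j * x (suc j)) (ℕ.m∸n+n≡m (Nat.s≤s⁻¹ j≤s))))))

  if-cong : ∀ {b b′ : Bool} {x x′ : Carrier} → b ≡ b′ → x ≈ x′ → (if b then x else 0#) ≈ (if b′ then x′ else 0#)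
  if-cong {true}  refl x≈x′ = x≈x′
  if-cong {false} refl _    = ≈-refl

  if-*ˡ : ∀ b a x → (if b then a * x else 0#) ≈ a * (if b then x else 0#)
  if-*ˡ true  a x = ≈-refl
  if-*ˡ false a x = ≈-sym (zeroʳ a)

  sumOf-guarded : ∀ {X : Set} b (xs : List X) K g →
    sumOf xs (λ x → if b then K * g x else 0#) ≈ (if b then K * sumOf xs g else 0#)
  sumOf-guarded true  xs K g = ≈-sym (*-distribˡ-sumOf xs K g)
  sumOf-guarded false xs K g = sumOf-zero xs (λ _ → ≈-refl)

  -- Weights of the part of a new first column from some row downwards, when a 1 of the column lies above that
  -- row (belowOneWeight) or does not (freshWeight: the part must then contain a 1, and its first 1 costs no q).
  belowOneWeight : ℕ → (ℕ → Bool) → (ℕ → Carrier) → List Bool → Carrier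
  belowOneWeight k U y c =
    if onesAllowed k c U then pow q (count k (oneAt c)) * y (stillUnrestricted k true c U) else 0#

  freshWeight : ℕ → (ℕ → Bool) → (ℕ → Carrier) → List Bool → Carrier
  freshWeight k U y c =
    if any (oneAt c) (upTo k) ∧ onesAllowed k c U
    then pow q (count k (oneAt c) ∸ 1) * y (stillUnrestricted k false c U) else 0#

  sum-belowOneWeight : ∀ k U y → sumOf (boolLists k) (belowOneWeight k U y) ≈ binomialSum (count k U) y
  sum-belowOneWeight zero    U y = ≈-trans (+-identityʳ _) (≈-trans (*-identityˡ _) (≈-sym (binomialSum-zero y)))
  sum-belowOneWeight (suc k) U y = begin
    sumOf (boolLists (suc k)) (belowOneWeight (suc k) U y)
      ≈⟨ sumOf-boolLists-suc k _ ⟩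
    sumOf (boolLists k) (belowOneWeight (suc k) U y ∘ (true ∷_))
      + sumOf (boolLists k) (belowOneWeight (suc k) U y ∘ (false ∷_))
      ≈⟨ +-cong (sumOf-cong (boolLists k) oneOnTop) (sumOf-cong (boolLists k) zeroOnTop) ⟩
    sumOf (boolLists k) (oneOnTopWeight (U 0)) + sumOf (boolLists k) (belowOneWeight k U′ y)
      ≈⟨ byTopRow (U 0) ⟩
    binomialSum (fromBool (U 0) Nat.+ count k U′) y
      ≡⟨ cong (λ s → binomialSum s y) (sym (count-suc k U)) ⟩
    binomialSum (count (suc k) U) y ∎
    where
    U′ : ℕ → Bool
    U′ = U ∘ suc
    oneOnTopWeight : Bool → List Bool → Carrier
    oneOnTopWeight u c = if u ∧ onesAllowed k c U′
      then pow q (suc (count k (oneAt c))) * y (fromBool u Nat.+ stillUnrestricted k true c U′) else 0#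
    oneOnTop : ∀ c → belowOneWeight (suc k) U y (true ∷ c) ≈ oneOnTopWeight (U 0) c
    oneOnTop c = if-cong (onesAllowed-∷ k true c U)
      (reflexive (cong₂ (λ n s → pow q n * y s) (count-oneAt-∷ k true c) (stillUnrestricted-∷ k true true c U)))
    zeroOnTop : ∀ c → belowOneWeight (suc k) U y (false ∷ c) ≈ belowOneWeight k U′ y c
    zeroOnTop c = if-cong (onesAllowed-∷ k false c U)
      (reflexive (cong₂ (λ n s → pow q n * y s) (count-oneAt-∷ k false c) (stillUnrestricted-∷ k true false c U)))
    byTopRow : ∀ u → sumOf (boolLists k) (oneOnTopWeight u) + sumOf (boolLists k) (belowOneWeight k U′ y)
                   ≈ binomialSum (fromBool u Nat.+ count k U′) y
    byTopRow true  = ≈-trans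
      (+-congʳ (≈-trans
        (sumOf-cong (boolLists k) (λ c → ≈-trans (if-cong {onesAllowed k c U′} refl (*-assoc _ _ _)) (if-*ˡ _ q _)))
        (≈-trans (≈-sym (*-distribˡ-sumOf (boolLists k) q _)) (*-congˡ (sum-belowOneWeight k U′ (y ∘ suc))))))
      (≈-trans (+-congˡ (sum-belowOneWeight k U′ y)) (≈-sym (binomialSum-suc (count k U′) y)))
    byTopRow false = ≈-trans (+-congʳ (sumOf-zero (boolLists k) (λ _ → ≈-refl)))
      (≈-trans (+-identityˡ _) (sum-belowOneWeight k U′ y))

  sum-freshWeight : ∀ k U y → sumOf (boolLists k) (freshWeight k U y) ≈ tailSum (count k U) y
  sum-freshWeight zero    U y = ≈-trans (+-identityʳ _) (≈-sym (tailSum-zero y))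
  sum-freshWeight (suc k) U y = begin
    sumOf (boolLists (suc k)) (freshWeight (suc k) U y)
      ≈⟨ sumOf-boolLists-suc k _ ⟩
    sumOf (boolLists k) (freshWeight (suc k) U y ∘ (true ∷_))
      + sumOf (boolLists k) (freshWeight (suc k) U y ∘ (false ∷_))
      ≈⟨ +-cong (sumOf-cong (boolLists k) oneOnTop) (sumOf-cong (boolLists k) zeroOnTop) ⟩
    sumOf (boolLists k) (oneOnTopWeight (U 0)) + sumOf (boolLists k) (zeroOnTopWeight (U 0))
      ≈⟨ byTopRow (U 0) ⟩
    tailSum (fromBool (U 0) Nat.+ count k U′) y
      ≡⟨ cong (λ s → tailSum s y) (sym (count-suc k U)) ⟩
    tailSum (count (suc k) U) y ∎
    where
    U′ : ℕ → Bool
    U′ = U ∘ suc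
    oneOnTopWeight zeroOnTopWeight : Bool → List Bool → Carrier
    oneOnTopWeight u c = if u ∧ onesAllowed k c U′
      then pow q (count k (oneAt c)) * y (fromBool u Nat.+ stillUnrestricted k true c U′) else 0#
    zeroOnTopWeight u c = if any (oneAt c) (upTo k) ∧ onesAllowed k c U′
      then pow q (count k (oneAt c) ∸ 1) * y (fromBool u Nat.+ stillUnrestricted k false c U′) else 0#
    oneOnTop : ∀ c → freshWeight (suc k) U y (true ∷ c) ≈ oneOnTopWeight (U 0) c
    oneOnTop c = if-cong (cong₂ _∧_ (any-oneAt-∷ k true c) (onesAllowed-∷ k true c U))
      (reflexive (cong₂ (λ n s → pow q n * y s) (cong (_∸ 1) (count-oneAt-∷ k true c))
                                                 (stillUnrestricted-∷ k false true c U)))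
    zeroOnTop : ∀ c → freshWeight (suc k) U y (false ∷ c) ≈ zeroOnTopWeight (U 0) c
    zeroOnTop c = if-cong (cong₂ _∧_ (any-oneAt-∷ k false c) (onesAllowed-∷ k false c U))
      (reflexive (cong₂ (λ n s → pow q n * y s) (cong (_∸ 1) (count-oneAt-∷ k false c))
                                                 (stillUnrestricted-∷ k false false c U)))
    byTopRow : ∀ u → sumOf (boolLists k) (oneOnTopWeight u) + sumOf (boolLists k) (zeroOnTopWeight u)
                   ≈ tailSum (fromBool u Nat.+ count k U′) y
    byTopRow true  = ≈-trans (+-cong (sum-belowOneWeight k U′ (y ∘ suc)) (sum-freshWeight k U′ (y ∘ suc)))
      (≈-sym (tailSum-suc (count k U′) y))
    byTopRow false = ≈-trans (+-congʳ (sumOf-zero (boolLists k) (λ _ → ≈-refl)))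
      (≈-trans (+-identityˡ _) (sum-freshWeight k U′ y))

  -- D₁ and E₁ with the powers of β removed: D₁ i j · β^j = β^i · D₀ i j, and likewise for E₁ (see D₁-conj).
  e₀ : ℕ → ℕ → Carrier
  e₀ i j = α⁻¹ * pow q j * fromℕ (i C j) + Σ< j (λ r → fromℕ ((i ∸ j Nat.+ r) C r) * pow q r)

  D₀ E₀ : Mat
  D₀ i j = if j Nat.≡ᵇ suc i then 1# else 0#
  E₀ i j = if j Nat.≤ᵇ i then e₀ i j else 0#

  factor₀ : Bool → Mat
  factor₀ true  = D₀
  factor₀ false = E₀

  -- Only the entries j ≤ i + 1 of row i are used: all matrices here vanish beyond the superdiagonal (Banded).
  colMul : Mat → (ℕ → Carrier) → ℕ → Carrier
  colMul M x i = Σ< (suc (suc i)) (λ j → M i j * x j)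

  colProd : List Mat → (ℕ → Carrier) → ℕ → Carrier
  colProd Ms x = foldr colMul x Ms

  colMul-cong : ∀ M {x x′} → (∀ j → x j ≈ x′ j) → ∀ i → colMul M x i ≈ colMul M x′ i
  colMul-cong M eq i = Σ<-cong (suc (suc i)) (λ j → *-congˡ (eq j))

  colProd-cong : ∀ Ms {x x′} → (∀ j → x j ≈ x′ j) → ∀ i → colProd Ms x i ≈ colProd Ms x′ i
  colProd-cong []       eq i = eq i
  colProd-cong (M ∷ Ms) eq i = colMul-cong M (colProd-cong Ms eq) i

  colProd-∷ʳ : ∀ w b x → colProd (map factor₀ (w ∷ʳ b)) x ≡ colProd (map factor₀ w) (colMul (factor₀ b) x)
  colProd-∷ʳ w b x = trans (cong (λ Ms → colProd Ms x) (List.map-++ factor₀ w (b ∷ [])))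
                           (List.foldr-++ colMul x (map factor₀ w) (factor₀ b ∷ []))

  colMul-D₀ : ∀ x i → colMul D₀ x i ≈ x (suc i)
  colMul-D₀ x i = begin
    Σ< (suc i) (λ j → D₀ i j * x j) + D₀ i (suc i) * x (suc i)
      ≈⟨ +-cong (Σ<-zero (suc i) offDiagonal) (*-congʳ (reflexive (cong (if_then 1# else 0#) (≡ᵇ-refl i)))) ⟩
    0# + 1# * x (suc i)
      ≈⟨ ≈-trans (+-identityˡ _) (*-identityˡ _) ⟩
    x (suc i) ∎
    where
    offDiagonal : ∀ j → j < suc i → D₀ i j * x j ≈ 0#
    offDiagonal j j<1+i rewrite ≢⇒≡ᵇ-false (ℕ.<⇒≢ j<1+i) = zeroˡ (x j)

  colMul-E₀ : ∀ x i → colMul E₀ x i ≈ α⁻¹ * binomialSum i x + tailSum i x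
  colMul-E₀ x i = begin
    Σ< (suc i) (λ j → E₀ i j * x j) + E₀ i (suc i) * x (suc i)
      ≈⟨ +-cong (Σ<-cong-< (suc i) lower) aboveDiagonal ⟩
    Σ< (suc i) (λ j → α⁻¹ * (fromℕ (i C j) * pow q j * x j) + Σ< j (coeff j) * x j) + 0#
      ≈⟨ +-identityʳ _ ⟩
    Σ< (suc i) (λ j → α⁻¹ * (fromℕ (i C j) * pow q j * x j) + Σ< j (coeff j) * x j)
      ≈⟨ Σ<-+ (suc i) _ _ ⟩
    Σ< (suc i) (λ j → α⁻¹ * (fromℕ (i C j) * pow q j * x j)) + tailSum i x
      ≈⟨ +-congʳ (*-distribˡ-Σ< (suc i) α⁻¹ _) ⟨
    α⁻¹ * binomialSum i x + tailSum i x ∎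
    where
    coeff : ℕ → ℕ → Carrier
    coeff j r = fromℕ ((i ∸ j Nat.+ r) C r) * pow q r
    aboveDiagonal : E₀ i (suc i) * x (suc i) ≈ 0#
    aboveDiagonal rewrite >⇒≤ᵇ-false (ℕ.n<1+n i) = zeroˡ _
    lower : ∀ j → j < suc i → E₀ i j * x j ≈ α⁻¹ * (fromℕ (i C j) * pow q j * x j) + Σ< j (coeff j) * x j
    lower j j<1+i = ≈-trans (*-congʳ (reflexive (cong (if_then e₀ i j else 0#) (≤⇒≤ᵇ-true (Nat.s≤s⁻¹ j<1+i)))))
      (≈-trans (distribʳ _ _ _) (+-congʳ (begin
      α⁻¹ * pow q j * fromℕ (i C j) * x j     ≈⟨ *-congʳ (*-assoc _ _ _) ⟩
      α⁻¹ * (pow q j * fromℕ (i C j)) * x j   ≈⟨ *-assoc _ _ _ ⟩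
      α⁻¹ * ((pow q j * fromℕ (i C j)) * x j) ≈⟨ *-congˡ (*-congʳ (*-comm _ _)) ⟩
      α⁻¹ * (fromℕ (i C j) * pow q j * x j)   ∎)))

  firstColumnWeight : ℕ → (ℕ → Bool) → (ℕ → Carrier) → List Bool → Carrier
  firstColumnWeight k U y c =
    if any (oneAt c) (upTo k) ∧ onesAllowed k c U
    then pow q (count k (oneAt c) ∸ 1) * (pow α⁻¹ (fromBool (oneAt c 0)) * y (stillUnrestricted k false c U)) else 0#

  sum-firstColumnWeight : ∀ k U y → U 0 ≡ true →
    sumOf (boolLists (suc k)) (firstColumnWeight (suc k) U y) ≈ colMul E₀ (y ∘ suc) (count k (U ∘ suc))
  sum-firstColumnWeight k U y top = begin
    sumOf (boolLists (suc k)) (firstColumnWeight (suc k) U y)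
      ≈⟨ sumOf-boolLists-suc k _ ⟩
    sumOf (boolLists k) (firstColumnWeight (suc k) U y ∘ (true ∷_))
      + sumOf (boolLists k) (firstColumnWeight (suc k) U y ∘ (false ∷_))
      ≈⟨ +-cong (sumOf-cong (boolLists k) oneOnTop) (sumOf-cong (boolLists k) zeroOnTop) ⟩
    sumOf (boolLists k) (λ c → α⁻¹ * belowOneWeight k U′ (y ∘ suc) c) + sumOf (boolLists k) (freshWeight k U′ (y ∘ suc))
      ≈⟨ +-cong (≈-trans (≈-sym (*-distribˡ-sumOf (boolLists k) α⁻¹ _)) (*-congˡ (sum-belowOneWeight k U′ (y ∘ suc))))
                (sum-freshWeight k U′ (y ∘ suc)) ⟩
    α⁻¹ * binomialSum (count k U′) (y ∘ suc) + tailSum (count k U′) (y ∘ suc)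
      ≈⟨ colMul-E₀ (y ∘ suc) (count k U′) ⟨
    colMul E₀ (y ∘ suc) (count k U′) ∎
    where
    U′ : ℕ → Bool
    U′ = U ∘ suc
    oneOnTop : ∀ c → firstColumnWeight (suc k) U y (true ∷ c) ≈ α⁻¹ * belowOneWeight k U′ (y ∘ suc) c
    oneOnTop c = ≈-trans
      (if-cong (trans (cong₂ _∧_ (any-oneAt-∷ k true c) (onesAllowed-∷ k true c U)) (cong (_∧ onesAllowed k c U′) top))
        (reflexive (cong₂ (λ n s → pow q n * (pow α⁻¹ 1 * y s)) (cong (_∸ 1) (count-oneAt-∷ k true c))
          (trans (stillUnrestricted-∷ k false true c U)
                 (cong (λ u → fromBool u Nat.+ stillUnrestricted k true c U′) top)))))
      (≈-trans (if-cong {onesAllowed k c U′} refl (≈-trans (*-congˡ (*-congʳ (*-identityʳ α⁻¹))) (*-leftCommute _ α⁻¹ _)))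
               (if-*ˡ (onesAllowed k c U′) α⁻¹ _))
    zeroOnTop : ∀ c → firstColumnWeight (suc k) U y (false ∷ c) ≈ freshWeight k U′ (y ∘ suc) c
    zeroOnTop c = if-cong (cong₂ _∧_ (any-oneAt-∷ k false c) (onesAllowed-∷ k false c U))
      (≈-trans (reflexive (cong₂ (λ n s → pow q n * (1# * y s)) (cong (_∸ 1) (count-oneAt-∷ k false c))
          (trans (stillUnrestricted-∷ k false false c U)
                 (cong (λ u → fromBool u Nat.+ stillUnrestricted k false c U′) top))))
        (*-congˡ (*-identityˡ _)))

  -- A: the new column has a 1; V: its 1's lie in unrestricted rows; C₁, C₂: conditions (1), (2) for the rest.
  weightOf-withColumn : ∀ m A C₁ V C₂ N n f b Y → (A ≡ true → 1 ≤ N) → (C₁ ≡ true → m ≤ n) →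
    (if (A ∧ C₁) ∧ (V ∧ C₂) then pow q ((N Nat.+ n) ∸ suc m) * (pow α⁻¹ (fromBool b Nat.+ f) * Y) else 0#)
    ≈ (if C₁ ∧ C₂
       then (pow q (n ∸ m) * pow α⁻¹ f) * (if A ∧ V then pow q (N ∸ 1) * (pow α⁻¹ (fromBool b) * Y) else 0#)
       else 0#)
  weightOf-withColumn m false C₁ V C₂ N n f b Y _ _ = ≈-sym (guardedZero (C₁ ∧ C₂))
    where
    guardedZero : ∀ g → (if g then (pow q (n ∸ m) * pow α⁻¹ f) * 0# else 0#) ≈ 0#
    guardedZero true  = zeroʳ _
    guardedZero false = ≈-refl
  weightOf-withColumn m true false V C₂ N n f b Y _ _ = ≈-refl
  weightOf-withColumn m true true V C₂ zero n f b Y 1≤0 _ with () ← 1≤0 refl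
  weightOf-withColumn m true true V C₂ (suc N) n f b Y _ m≤n = ≈-trans (if-cong {V ∧ C₂} refl regroup) (nest V C₂)
    where
    K : Carrier
    K = pow q (n ∸ m) * pow α⁻¹ f
    regroup : pow q ((N Nat.+ n) ∸ m) * (pow α⁻¹ (fromBool b Nat.+ f) * Y) ≈ K * (pow q N * (pow α⁻¹ (fromBool b) * Y))
    regroup = begin
      pow q ((N Nat.+ n) ∸ m) * (pow α⁻¹ (fromBool b Nat.+ f) * Y)
        ≡⟨ cong (λ e → pow q e * (pow α⁻¹ (fromBool b Nat.+ f) * Y)) (ℕ.+-∸-assoc N (m≤n refl)) ⟩
      pow q (N Nat.+ (n ∸ m)) * (pow α⁻¹ (fromBool b Nat.+ f) * Y)
        ≈⟨ *-cong (pow-+ q N (n ∸ m)) (*-congʳ (pow-+ α⁻¹ (fromBool b) f)) ⟩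
      (pow q N * pow q (n ∸ m)) * ((pow α⁻¹ (fromBool b) * pow α⁻¹ f) * Y)
        ≈⟨ *-Solver.solve 5 (λ a b c d e → (a ⊕ b) ⊕ ((c ⊕ d) ⊕ e) ⊜ (b ⊕ d) ⊕ (a ⊕ (c ⊕ e))) ≈-refl _ _ _ _ _ ⟩
      K * (pow q N * (pow α⁻¹ (fromBool b) * Y)) ∎
    nest : ∀ v c {X} → (if v ∧ c then K * X else 0#) ≈ (if c then K * (if v then X else 0#) else 0#)
    nest true  true  = ≈-refl
    nest true  false = ≈-refl
    nest false true  = ≈-sym (zeroʳ K)
    nest false false = ≈-refl

  tableauWeight-withColumn : ∀ k m y c e → let open Statistics k m e in
    tableauWeight k (suc m) y (withColumn c e)
      ≈ (if isTableau then (pow q (ones ∸ m) * pow α⁻¹ topOnes) * firstColumnWeight k unrestricted y c else 0#)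
  tableauWeight-withColumn k m y c e = ≈-trans
    (reflexive (weightOf-cong (suc m) y (cong₂ _∧_ C.columnsHaveOnes≡ C.noForbiddenZeros≡)
                              C.ones≡ C.topOnes≡ C.unrestrictedRows≡))
    (weightOf-withColumn m (any (oneAt c) (upTo k)) S.columnsHaveOnes (onesAllowed k c S.unrestricted) S.noForbiddenZeros
      (count k (oneAt c)) S.ones S.topOnes (oneAt c 0) (y (stillUnrestricted k false c S.unrestricted))
      (1≤count k (oneAt c)) (ones≥columns k m e))
    where
    module C = FirstColumn k m (withColumn c e)
    module S = Statistics k m e

  F′-addColumn : ∀ a l y → F′ (suc a ∷ map suc l) y ≈ F′ (a ∷ l) (λ s → colMul E₀ (y ∘ suc) (s ∸ 1))
  F′-addColumn a l y = begin
    sumOf (fillingsOf (map suc (a ∷ l))) (λ T → tableauWeight (suc (length (map suc l))) (suc a) y (ent T))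
      ≡⟨ cong (λ n → sumOf (fillingsOf (map suc (a ∷ l))) (λ T → tableauWeight (suc n) (suc a) y (ent T)))
              (List.length-map suc l) ⟩
    sumOf (fillingsOf (map suc (a ∷ l))) (λ T → tableauWeight k (suc a) y (ent T))
      ≈⟨ sumOf-fillingsOf-map-suc (a ∷ l) _ ⟩
    sumOf (fillingsOf (a ∷ l)) (λ T → sumOf (boolLists k) (λ c → tableauWeight k (suc a) y (ent (consColumn c T))))
      ≈⟨ sumOf-fillingsOf-cong (a ∷ l) columnSum ⟩
    F′ (a ∷ l) y′ ∎
    where
    k : ℕ
    k = length (a ∷ l)
    y′ : ℕ → Carrier
    y′ s = colMul E₀ (y ∘ suc) (s ∸ 1)
    columnSum : ∀ T → length T ≡ k →
      sumOf (boolLists k) (λ c → tableauWeight k (suc a) y (ent (consColumn c T))) ≈ tableauWeight k a y′ (ent T)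
    columnSum T |T| = begin
      sumOf (boolLists k) (λ c → tableauWeight k (suc a) y (ent (consColumn c T)))
        ≈⟨ sumOf-boolLists-cong k (λ c |c| → ≈-trans
             (reflexive (tableauWeight-cong k (suc a) y (ent-consColumn c T (trans |c| (sym |T|)))))
             (tableauWeight-withColumn k a y c (ent T))) ⟩
      sumOf (boolLists k) (λ c → if isTableau then K * firstColumnWeight k unrestricted y c else 0#)
        ≈⟨ sumOf-guarded isTableau (boolLists k) K _ ⟩
      (if isTableau then K * sumOf (boolLists k) (firstColumnWeight k unrestricted y) else 0#)
        ≈⟨ if-cong {isTableau} refl (≈-trans (*-congˡ firstColumn) (*-assoc _ _ _)) ⟩
      tableauWeight k a y′ (ent T) ∎
      where
      open Statistics k a (ent T)
      K : Carrier
      K = pow q (ones ∸ a) * pow α⁻¹ topOnes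
      firstColumn : sumOf (boolLists k) (firstColumnWeight k unrestricted y) ≈ y′ unrestrictedRows
      firstColumn = ≈-trans (sum-firstColumnWeight (length l) unrestricted y (unrestricted-top k a (ent T)))
        (reflexive (cong y′ (sym (trans (count-suc (length l) unrestricted)
          (cong (λ b → fromBool b Nat.+ count (length l) (unrestricted ∘ suc)) (unrestricted-top k a (ent T)))))))

  F′≈colProd : ∀ {λ′} → Shape λ′ → ∀ y → F′ λ′ y ≈ colProd (map factor₀ (φ λ′)) (y ∘ suc) 0
  F′≈colProd single y = ≈-trans (+-identityʳ _) (≈-trans (*-identityˡ _) (*-identityˡ _))
  F′≈colProd (addEmptyRow {a} {l} s) y = begin
    F′ (a ∷ (l ∷ʳ 0)) y
      ≈⟨ F′-addEmptyRow a l y ⟩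
    F′ (a ∷ l) (y ∘ suc)
      ≈⟨ F′≈colProd s (y ∘ suc) ⟩
    colProd (map factor₀ w) (y ∘ suc ∘ suc) 0
      ≈⟨ colProd-cong (map factor₀ w) (colMul-D₀ (y ∘ suc)) 0 ⟨
    colProd (map factor₀ w) (colMul D₀ (y ∘ suc)) 0
      ≡⟨ cong (λ v → v 0) (colProd-∷ʳ w true (y ∘ suc)) ⟨
    colProd (map factor₀ (w ∷ʳ true)) (y ∘ suc) 0
      ≡⟨ cong (λ w′ → colProd (map factor₀ w′) (y ∘ suc) 0) (φ-addEmptyRow a l) ⟨
    colProd (map factor₀ (φ (a ∷ (l ∷ʳ 0)))) (y ∘ suc) 0 ∎
    where
    w : List Bool
    w = φ (a ∷ l)
  F′≈colProd (addColumn {a} {l} s) y = begin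
    F′ (suc a ∷ map suc l) y
      ≈⟨ F′-addColumn a l y ⟩
    F′ (a ∷ l) (λ u → colMul E₀ (y ∘ suc) (u ∸ 1))
      ≈⟨ F′≈colProd s (λ u → colMul E₀ (y ∘ suc) (u ∸ 1)) ⟩
    colProd (map factor₀ w) (colMul E₀ (y ∘ suc)) 0
      ≡⟨ cong (λ v → v 0) (colProd-∷ʳ w false (y ∘ suc)) ⟨
    colProd (map factor₀ (w ∷ʳ false)) (y ∘ suc) 0
      ≡⟨ cong (λ w′ → colProd (map factor₀ w′) (y ∘ suc) 0) (φ-addColumn a l) ⟨
    colProd (map factor₀ (φ (suc a ∷ map suc l))) (y ∘ suc) 0 ∎
    where
    w : List Bool
    w = φ (a ∷ l)

  Banded : Mat → Set ℓ
  Banded M = ∀ i j → suc (suc i) ≤ j → M i j ≈ 0#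

  D₁-banded : Banded D₁
  D₁-banded i j 2+i≤j = reflexive (cong (if_then β⁻¹ else 0#) (≢⇒≡ᵇ-false (ℕ.>⇒≢ 2+i≤j)))

  E₁-banded : Banded E₁
  E₁-banded i j 2+i≤j = reflexive (cong (if_then pow β (i ∸ j) * e₀ i j else 0#) (>⇒≤ᵇ-false (ℕ.<⇒≤ 2+i≤j)))

  factor-banded : ∀ w → All Banded (map factor w)
  factor-banded []          = []
  factor-banded (true ∷ w)  = D₁-banded ∷ factor-banded w
  factor-banded (false ∷ w) = E₁-banded ∷ factor-banded w

  D₁+E₁-banded : ∀ n → All Banded (replicate n (D₁ +ᴹ E₁))
  D₁+E₁-banded zero    = []
  D₁+E₁-banded (suc n) = D₁+E₁ ∷ D₁+E₁-banded n
    where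
    D₁+E₁ : Banded (D₁ +ᴹ E₁)
    D₁+E₁ i j 2+i≤j = ≈-trans (+-cong (D₁-banded i j 2+i≤j) (E₁-banded i j 2+i≤j)) (+-identityʳ 0#)

  rowMul-colMul : ∀ N v M x → Banded M →
    Σ< (suc N) (λ j → rowMul N v M j * x j) ≈ Σ< N (λ i → v i * colMul M x i)
  rowMul-colMul N v M x banded = begin
    Σ< (suc N) (λ j → Σ< N (λ i → v i * M i j) * x j)
      ≈⟨ Σ<-cong (suc N) (λ j → *-distribʳ-Σ< N (x j) (λ i → v i * M i j)) ⟩
    Σ< (suc N) (λ j → Σ< N (λ i → v i * M i j * x j))
      ≈⟨ Σ<-comm (suc N) N (λ j i → v i * M i j * x j) ⟩
    Σ< N (λ i → Σ< (suc N) (λ j → v i * M i j * x j))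
      ≈⟨ Σ<-cong N (λ i → ≈-trans (Σ<-cong (suc N) (λ j → *-assoc _ _ _)) (≈-sym (*-distribˡ-Σ< (suc N) (v i) _))) ⟩
    Σ< N (λ i → v i * Σ< (suc N) (λ j → M i j * x j))
      ≈⟨ Σ<-cong-< N (λ i i<N → *-congˡ (truncate i i<N)) ⟩
    Σ< N (λ i → v i * colMul M x i) ∎
    where
    truncate : ∀ i → i < N → Σ< (suc N) (λ j → M i j * x j) ≈ colMul M x i
    truncate i i<N = ≈-trans
      (reflexive (cong (λ n → Σ< n (λ j → M i j * x j)) (sym (ℕ.m∸n+n≡m (s≤s i<N)))))
      (Σ<-extend (suc N ∸ suc (suc i)) (suc (suc i)) (λ j 2+i≤j → ≈-trans (*-congʳ (banded i j 2+i≤j)) (zeroˡ _)))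

  rowProd-colProd : ∀ Ms N v x → All Banded Ms →
    Σ< (length Ms Nat.+ N) (λ j → rowProd N v Ms j * x j) ≈ Σ< N (λ i → v i * colProd Ms x i)
  rowProd-colProd []       N v x []                = ≈-refl
  rowProd-colProd (M ∷ Ms) N v x (banded ∷ bandeds) = begin
    Σ< (suc (length Ms Nat.+ N)) (λ j → rowProd (suc N) (rowMul N v M) Ms j * x j)
      ≡⟨ cong (λ n → Σ< n (λ j → rowProd (suc N) (rowMul N v M) Ms j * x j)) (sym (ℕ.+-suc (length Ms) N)) ⟩
    Σ< (length Ms Nat.+ suc N) (λ j → rowProd (suc N) (rowMul N v M) Ms j * x j)
      ≈⟨ rowProd-colProd Ms (suc N) (rowMul N v M) x bandeds ⟩
    Σ< (suc N) (λ j → rowMul N v M j * colProd Ms x j)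
      ≈⟨ rowMul-colMul N v M (colProd Ms x) banded ⟩
    Σ< N (λ i → v i * colProd (M ∷ Ms) x i) ∎

  WMV≈colProd : ∀ Ms → All Banded Ms → WMV Ms ≈ colProd Ms (λ _ → 1#) 0
  WMV≈colProd Ms bandeds = begin
    Σ< (suc (length Ms)) (rowProd 1 W₁ Ms)
      ≡⟨ cong (λ n → Σ< n (rowProd 1 W₁ Ms)) (ℕ.+-comm 1 (length Ms)) ⟩
    Σ< (length Ms Nat.+ 1) (rowProd 1 W₁ Ms)
      ≈⟨ Σ<-cong (length Ms Nat.+ 1) (λ j → ≈-sym (*-identityʳ _)) ⟩
    Σ< (length Ms Nat.+ 1) (λ j → rowProd 1 W₁ Ms j * 1#)
      ≈⟨ rowProd-colProd Ms 1 W₁ (λ _ → 1#) bandeds ⟩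
    0# + 1# * colProd Ms (λ _ → 1#) 0
      ≈⟨ ≈-trans (+-identityˡ _) (*-identityˡ _) ⟩
    colProd Ms (λ _ → 1#) 0 ∎

  sumOf-bounded-suc : ∀ k m (h : List ℕ → Carrier) →
    sumOf (bounded (suc k) m) h ≈ sumOf (upTo (suc m)) (λ a → sumOf (bounded k a) (h ∘ (a ∷_)))
  sumOf-bounded-suc k m h = ≈-trans (sumOf-concatMap (λ a → map (a ∷_) (bounded k a)) (upTo (suc m)) h)
    (sumOf-cong (upTo (suc m)) (λ a → reflexive (sumOf-map (a ∷_) (bounded k a) h)))

  sumOf-bounded-cong : ∀ k m {h h′ : List ℕ → Carrier} →
    (∀ r → length r ≡ k → Linked _≥_ (m ∷ r) → h r ≈ h′ r) → sumOf (bounded k m) h ≈ sumOf (bounded k m) h′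
  sumOf-bounded-cong zero    m eq = +-congʳ (eq [] refl [-])
  sumOf-bounded-cong (suc k) m {h} {h′} eq = ≈-trans (sumOf-bounded-suc k m h) (≈-trans
    (sumOf-upTo-cong (suc m) (λ a a≤m → sumOf-bounded-cong k a (λ r |r| ar → eq (a ∷ r) (cong suc |r|) (Nat.s≤s⁻¹ a≤m ∷ ar))))
    (≈-sym (sumOf-bounded-suc k m h′)))

  sumOf-partitionsOfExpanse : ∀ N (h : List ℕ → Carrier) →
    sumOf (partitionsOfExpanse N) h ≈ sumOf (upTo N) (λ k → sumOf (bounded k (N ∸ suc k)) (h ∘ ((N ∸ suc k) ∷_)))
  sumOf-partitionsOfExpanse N h = ≈-trans (sumOf-concatMap (λ k → map ((N ∸ suc k) ∷_) (bounded k (N ∸ suc k))) (upTo N) h)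
    (sumOf-cong (upTo N) (λ k → reflexive (sumOf-map ((N ∸ suc k) ∷_) (bounded k (N ∸ suc k)) h)))

  sumOf-partitionsOfExpanse-cong : ∀ N {h h′ : List ℕ → Carrier} →
    (∀ λ′ → Linked _≥_ λ′ → expanse λ′ ≡ N → h λ′ ≈ h′ λ′) →
    sumOf (partitionsOfExpanse N) h ≈ sumOf (partitionsOfExpanse N) h′
  sumOf-partitionsOfExpanse-cong N {h} {h′} eq = ≈-trans (sumOf-partitionsOfExpanse N h) (≈-trans
    (sumOf-upTo-cong N (λ k k<N → sumOf-bounded-cong k (N ∸ suc k)
      (λ r |r| lk → eq _ lk (trans (cong (λ n → suc n Nat.+ (N ∸ suc k)) |r|) (ℕ.m+[n∸m]≡n k<N)))))
    (≈-sym (sumOf-partitionsOfExpanse N h′)))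

  -- The sum of g over all words with k letters S and m letters W.
  boundarySum : (List Bool → Carrier) → ℕ → ℕ → Carrier
  boundarySum g k m = sumOf (bounded k m) (λ r → g (boundaryFrom m r))

  boundarySum-suc : ∀ g k m → boundarySum g (suc k) m
    ≈ Σ< (suc m) (λ a → sumOf (bounded k a) (λ r → g (replicate (m ∸ a) false ++ true ∷ boundaryFrom a r)))
  boundarySum-suc g k m = ≈-trans (sumOf-bounded-suc k m _) (sumOf-upTo (suc m) _)

  boundarySum-suc-zero : ∀ g k → boundarySum g (suc k) 0 ≈ boundarySum (g ∘ (true ∷_)) k 0
  boundarySum-suc-zero g k = ≈-trans (boundarySum-suc g k 0) (+-identityˡ _)

  boundarySum-suc-suc : ∀ g k m →
    boundarySum g (suc k) (suc m) ≈ boundarySum (g ∘ (false ∷_)) (suc k) m + boundarySum (g ∘ (true ∷_)) k (suc m)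
  boundarySum-suc-suc g k m = begin
    boundarySum g (suc k) (suc m)
      ≈⟨ boundarySum-suc g k (suc m) ⟩
    Σ< (suc m) startsWith + startsWith (suc m)
      ≈⟨ +-cong (Σ<-cong-< (suc m) westFirst) southFirst ⟩
    Σ< (suc m) (λ a → sumOf (bounded k a) (λ r → g (false ∷ (replicate (m ∸ a) false ++ true ∷ boundaryFrom a r))))
      + boundarySum (g ∘ (true ∷_)) k (suc m)
      ≈⟨ +-congʳ (boundarySum-suc (g ∘ (false ∷_)) k m) ⟨
    boundarySum (g ∘ (false ∷_)) (suc k) m + boundarySum (g ∘ (true ∷_)) k (suc m) ∎
    where
    startsWith : ℕ → Carrier
    startsWith a = sumOf (bounded k a) (λ r → g (replicate (suc m ∸ a) false ++ true ∷ boundaryFrom a r))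
    westFirst : ∀ a → a < suc m →
      startsWith a ≈ sumOf (bounded k a) (λ r → g (false ∷ (replicate (m ∸ a) false ++ true ∷ boundaryFrom a r)))
    westFirst a a≤m = sumOf-cong (bounded k a) (λ r → reflexive
      (cong (λ z → g (replicate z false ++ true ∷ boundaryFrom a r)) (ℕ.+-∸-assoc 1 (Nat.s≤s⁻¹ a≤m))))
    southFirst : startsWith (suc m) ≈ boundarySum (g ∘ (true ∷_)) k (suc m)
    southFirst = sumOf-cong (bounded k (suc m)) (λ r → reflexive
      (cong (λ z → g (replicate z false ++ true ∷ boundaryFrom (suc m) r)) (ℕ.n∸n≡0 m)))

  sum-boundarySum : ∀ n (g : List Bool → Carrier) → Σ< (suc n) (λ k → boundarySum g k (n ∸ k)) ≈ sumOf (boolLists n) g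
  sum-boundarySum zero    g = +-identityˡ _
  sum-boundarySum (suc n) g = begin
    Σ< (suc (suc n)) (λ k → boundarySum g k (suc n ∸ k))
      ≈⟨ Σ<-suc (suc n) _ ⟩
    boundarySum gW 0 n + (Σ< n (λ k → boundarySum g (suc k) (n ∸ k)) + boundarySum g (suc n) (n ∸ n))
      ≈⟨ +-congˡ (+-cong (≈-trans (Σ<-cong-< n splitFirst) (Σ<-+ n _ _)) allSouth) ⟩
    boundarySum gW 0 n + ((Σ< n (λ k → boundarySum gW (suc k) (n ∸ suc k)) + Σ< n (λ k → boundarySum gS k (n ∸ k)))
                          + boundarySum gS n (n ∸ n))
      ≈⟨ regroup _ _ _ _ ⟩
    Σ< (suc n) (λ k → boundarySum gS k (n ∸ k)) + (boundarySum gW 0 n + Σ< n (λ k → boundarySum gW (suc k) (n ∸ suc k)))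
      ≈⟨ +-cong (sum-boundarySum n gS) (≈-trans (≈-sym (Σ<-suc n _)) (sum-boundarySum n gW)) ⟩
    sumOf (boolLists n) gS + sumOf (boolLists n) gW
      ≈⟨ sumOf-boolLists-suc n g ⟨
    sumOf (boolLists (suc n)) g ∎
    where
    gS gW : List Bool → Carrier
    gS = g ∘ (true ∷_)
    gW = g ∘ (false ∷_)
    splitFirst : ∀ k → k < n →
      boundarySum g (suc k) (n ∸ k) ≈ boundarySum gW (suc k) (n ∸ suc k) + boundarySum gS k (n ∸ k)
    splitFirst k k<n = begin
      boundarySum g (suc k) (n ∸ k)
        ≡⟨ cong (boundarySum g (suc k)) (ℕ.+-∸-assoc 1 k<n) ⟩
      boundarySum g (suc k) (suc (n ∸ suc k))
        ≈⟨ boundarySum-suc-suc g k (n ∸ suc k) ⟩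
      boundarySum gW (suc k) (n ∸ suc k) + boundarySum gS k (suc (n ∸ suc k))
        ≡⟨ cong (λ m → boundarySum gW (suc k) (n ∸ suc k) + boundarySum gS k m) (ℕ.+-∸-assoc 1 k<n) ⟨
      boundarySum gW (suc k) (n ∸ suc k) + boundarySum gS k (n ∸ k) ∎
    allSouth : boundarySum g (suc n) (n ∸ n) ≈ boundarySum gS n (n ∸ n)
    allSouth rewrite ℕ.n∸n≡0 n = boundarySum-suc-zero g n
    regroup : ∀ a b c d → a + ((b + c) + d) ≈ (c + d) + (a + b)
    regroup a b c d = ≈-trans (+-congˡ (+-assoc b c d)) (≈-trans (≈-sym (+-assoc a b (c + d))) (+-comm (a + b) (c + d)))

  sumOf-φ : ∀ n (g : List Bool → Carrier) → sumOf (partitionsOfExpanse (suc n)) (g ∘ φ) ≈ sumOf (boolLists n) g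
  sumOf-φ n g = begin
    sumOf (partitionsOfExpanse (suc n)) (g ∘ φ)
      ≈⟨ sumOf-partitionsOfExpanse (suc n) _ ⟩
    sumOf (upTo (suc n)) (λ k → sumOf (bounded k (n ∸ k)) (λ r → g (φ ((n ∸ k) ∷ r))))
      ≈⟨ sumOf-cong (upTo (suc n)) (λ k → sumOf-cong (bounded k (n ∸ k)) (λ r → reflexive (cong g (φ-cons (n ∸ k) r)))) ⟩
    sumOf (upTo (suc n)) (λ k → boundarySum g k (n ∸ k))
      ≈⟨ sumOf-upTo (suc n) _ ⟩
    Σ< (suc n) (λ k → boundarySum g k (n ∸ k))
      ≈⟨ sum-boundarySum n g ⟩
    sumOf (boolLists n) g ∎

  sumOf-colProd : ∀ n (x : ℕ → Carrier) i →
    sumOf (boolLists n) (λ w → colProd (map factor w) x i) ≈ colProd (replicate n (D₁ +ᴹ E₁)) x i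
  sumOf-colProd zero    x i = +-identityʳ _
  sumOf-colProd (suc n) x i = begin
    sumOf (boolLists (suc n)) (λ w → colProd (map factor w) x i)
      ≈⟨ sumOf-boolLists-suc n _ ⟩
    sumOf (boolLists n) (λ w → colMul D₁ (z w) i) + sumOf (boolLists n) (λ w → colMul E₁ (z w) i)
      ≈⟨ +-cong (linear D₁) (linear E₁) ⟩
    colMul D₁ Z i + colMul E₁ Z i
      ≈⟨ Σ<-+ (suc (suc i)) _ _ ⟨
    Σ< (suc (suc i)) (λ j → D₁ i j * Z j + E₁ i j * Z j)
      ≈⟨ Σ<-cong (suc (suc i)) (λ j → ≈-sym (distribʳ _ _ _)) ⟩
    colMul (D₁ +ᴹ E₁) Z i ∎
    where
    z : List Bool → ℕ → Carrier
    z w = colProd (map factor w) x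
    Z : ℕ → Carrier
    Z = colProd (replicate n (D₁ +ᴹ E₁)) x
    linear : ∀ M → sumOf (boolLists n) (λ w → colMul M (z w) i) ≈ colMul M Z i
    linear M = ≈-trans (sumOf-Σ< (boolLists n) (suc (suc i)) (λ w j → M i j * z w j))
      (Σ<-cong (suc (suc i)) (λ j → ≈-trans (≈-sym (*-distribˡ-sumOf (boolLists n) (M i j) (λ w → z w j)))
                                            (*-congˡ (sumOf-colProd n x j))))

  module _ (ββ⁻¹ : β * β⁻¹ ≈ 1#) where

    pow-inverse : ∀ j → pow β j * pow β⁻¹ j ≈ 1#
    pow-inverse zero    = *-identityˡ 1#
    pow-inverse (suc j) = begin
      (β * pow β j) * (β⁻¹ * pow β⁻¹ j) ≈⟨ *-interchange β (pow β j) β⁻¹ (pow β⁻¹ j) ⟩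
      (β * β⁻¹) * (pow β j * pow β⁻¹ j) ≈⟨ *-cong ββ⁻¹ (pow-inverse j) ⟩
      1# * 1#                           ≈⟨ *-identityˡ 1# ⟩
      1#                                ∎

    private
      vanishing : ∀ {a a′ : Carrier} u p v → a ≡ 0# → a′ ≡ 0# → a * u ≈ p * (a′ * v)
      vanishing u p v refl refl = ≈-trans (zeroˡ u) (≈-sym (≈-trans (*-congˡ (zeroˡ v)) (zeroʳ p)))

    D₁-conj : ∀ (x : ℕ → Carrier) i j → D₁ i j * (pow β j * x j) ≈ pow β i * (D₀ i j * x j)
    D₁-conj x i j with j ℕ.≟ suc i
    ... | yes refl = begin
      D₁ i (suc i) * (pow β (suc i) * x (suc i))
        ≡⟨ cong (λ b → (if b then β⁻¹ else 0#) * (pow β (suc i) * x (suc i))) (≡ᵇ-refl i) ⟩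
      β⁻¹ * ((β * pow β i) * x (suc i))
        ≈⟨ *-Solver.solve 4 (λ a b c d → a ⊕ ((b ⊕ c) ⊕ d) ⊜ (b ⊕ a) ⊕ (c ⊕ d)) ≈-refl β⁻¹ β (pow β i) (x (suc i)) ⟩
      (β * β⁻¹) * (pow β i * x (suc i))
        ≈⟨ ≈-trans (*-congʳ ββ⁻¹) (*-identityˡ _) ⟩
      pow β i * x (suc i)
        ≈⟨ *-congˡ (*-identityˡ _) ⟨
      pow β i * (1# * x (suc i))
        ≡⟨ cong (λ b → pow β i * ((if b then 1# else 0#) * x (suc i))) (≡ᵇ-refl i) ⟨
      pow β i * (D₀ i (suc i) * x (suc i)) ∎
    ... | no j≢1+i = vanishing _ _ _ (cong (if_then β⁻¹ else 0#) (≢⇒≡ᵇ-false j≢1+i))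
                                     (cong (if_then 1# else 0#) (≢⇒≡ᵇ-false j≢1+i))

    E₁-conj : ∀ (x : ℕ → Carrier) i j → E₁ i j * (pow β j * x j) ≈ pow β i * (E₀ i j * x j)
    E₁-conj x i j with j ℕ.≤? i
    ... | yes j≤i = begin
      E₁ i j * (pow β j * x j)
        ≡⟨ cong (λ b → (if b then pow β (i ∸ j) * e₀ i j else 0#) * (pow β j * x j)) (≤⇒≤ᵇ-true j≤i) ⟩
      (pow β (i ∸ j) * e₀ i j) * (pow β j * x j)
        ≈⟨ *-interchange _ _ _ _ ⟩
      (pow β (i ∸ j) * pow β j) * (e₀ i j * x j)
        ≈⟨ *-congʳ (pow-+ β (i ∸ j) j) ⟨
      pow β (i ∸ j Nat.+ j) * (e₀ i j * x j)
        ≡⟨ cong (λ n → pow β n * (e₀ i j * x j)) (ℕ.m∸n+n≡m j≤i) ⟩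
      pow β i * (e₀ i j * x j)
        ≡⟨ cong (λ b → pow β i * ((if b then e₀ i j else 0#) * x j)) (≤⇒≤ᵇ-true j≤i) ⟨
      pow β i * (E₀ i j * x j) ∎
    ... | no j≰i = vanishing _ _ _ (cong (if_then pow β (i ∸ j) * e₀ i j else 0#) (>⇒≤ᵇ-false (ℕ.≰⇒> j≰i)))
                                   (cong (if_then e₀ i j else 0#) (>⇒≤ᵇ-false (ℕ.≰⇒> j≰i)))

    colMul-conj : ∀ b (x : ℕ → Carrier) i →
      colMul (factor b) (λ j → pow β j * x j) i ≈ pow β i * colMul (factor₀ b) x i
    colMul-conj true  x i = ≈-trans (Σ<-cong (suc (suc i)) (D₁-conj x i)) (≈-sym (*-distribˡ-Σ< (suc (suc i)) (pow β i) _))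
    colMul-conj false x i = ≈-trans (Σ<-cong (suc (suc i)) (E₁-conj x i)) (≈-sym (*-distribˡ-Σ< (suc (suc i)) (pow β i) _))

    colProd-conj : ∀ w (x : ℕ → Carrier) i →
      colProd (map factor w) (λ j → pow β j * x j) i ≈ pow β i * colProd (map factor₀ w) x i
    colProd-conj []      x i = ≈-refl
    colProd-conj (b ∷ w) x i =
      ≈-trans (colMul-cong (factor b) (colProd-conj w x) i) (colMul-conj b (colProd (map factor₀ w) x) i)

    F≈WMV-shape : ∀ {λ′} → Shape λ′ → F λ′ ≈ WMV (map factor (φ λ′))
    F≈WMV-shape {λ′} s = begin
      F λ′                                                   ≡⟨ F≡F′ λ′ ⟩
      F′ λ′ (λ u → pow β⁻¹ (u ∸ 1))                          ≈⟨ F′≈colProd s (λ u → pow β⁻¹ (u ∸ 1)) ⟩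
      colProd (map factor₀ w) (pow β⁻¹) 0                    ≈⟨ *-identityˡ _ ⟨
      pow β 0 * colProd (map factor₀ w) (pow β⁻¹) 0          ≈⟨ colProd-conj w (pow β⁻¹) 0 ⟨
      colProd (map factor w) (λ j → pow β j * pow β⁻¹ j) 0   ≈⟨ colProd-cong (map factor w) pow-inverse 0 ⟩
      colProd (map factor w) (λ _ → 1#) 0                    ≈⟨ WMV≈colProd (map factor w) (factor-banded w) ⟨
      WMV (map factor w)                                     ∎
      where
      w : List Bool
      w = φ λ′


    F≈WMV : ∀ n λ′ → Linked _≥_ λ′ → expanse λ′ ≡ suc n → F λ′ ≈ WMV (map factor (φ λ′))
    F≈WMV n (a ∷ l) a∷l↓ _ = F≈WMV-shape (shape a l a∷l↓)

    Fexp≈WMV : ∀ n → Fexp (suc n) ≈ WMV (replicate n (D₁ +ᴹ E₁))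
    Fexp≈WMV n = begin
      sumOf (partitionsOfExpanse (suc n)) F
        ≈⟨ sumOf-partitionsOfExpanse-cong (suc n) (F≈WMV n) ⟩
      sumOf (partitionsOfExpanse (suc n)) (λ λ′ → WMV (map factor (φ λ′)))
        ≈⟨ sumOf-φ n (λ w → WMV (map factor w)) ⟩
      sumOf (boolLists n) (λ w → WMV (map factor w))
        ≈⟨ sumOf-cong (boolLists n) (λ w → WMV≈colProd (map factor w) (factor-banded w)) ⟩
      sumOf (boolLists n) (λ w → colProd (map factor w) (λ _ → 1#) 0)
        ≈⟨ sumOf-colProd n (λ _ → 1#) 0 ⟩
      colProd (replicate n (D₁ +ᴹ E₁)) (λ _ → 1#) 0
        ≈⟨ WMV≈colProd _ (D₁+E₁-banded n) ⟨
      WMV (replicate n (D₁ +ᴹ E₁)) ∎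

-- Only α⁻¹ enters the weights.
theorem3p1 : ∀ {c ℓ : Level} (R : CommutativeRing c ℓ) →
  let open CommutativeRing R in
  (q α α⁻¹ β β⁻¹ : Carrier) → α * α⁻¹ ≈ 1# → β * β⁻¹ ≈ 1# →
  (n : ℕ) → 1 ≤ n →
  let open WithRing R q α⁻¹ β β⁻¹ in
  ((λ′ : List ℕ) → Linked _≥_ λ′ → expanse λ′ ≡ suc n →
     F λ′ ≈ WMV (map factor (φ λ′)))
  × (Fexp (suc n) ≈ WMV (replicate n (D₁ +ᴹ E₁)))
theorem3p1 R q α α⁻¹ β β⁻¹ _ ββ⁻¹ n _ =
  F≈WMV R q α⁻¹ β β⁻¹ ββ⁻¹ n , Fexp≈WMV R q α⁻¹ β β⁻¹ ββ⁻¹ n
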